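{- Let $k\geq 2$ and $1\leq x\leq 2k-1$ be integers and let $n=2k+x$. Then $$\lambda^k(C_n)\geq \begin{cases} 2 & \text{if } x=1 \text{ and } k \text{ is even},\\ x+2 & \text{otherwise.}\end{cases}$$
   Context: $C_n$ is the (undirected) cycle on $n$ vertices and $K_n$ the complete graph on $n$ vertices. For a graph $G$ of order at most $n$ and $p\geq 1$, a $p$-labeled packing of $k$ copies of $G$ into $K_n$ is a map $f$ from $V(K_n)$ onto a set of exactly $p$ labels together with injections $\sigma_1,\dots,\sigma_k:V(G)\to V(K_n)$ such that (i) for $i\neq j$, the induced edge images $\sigma_i^*(E(G))$ and $\sigma_j^*(E(G))$ are disjoint, and (ii) for every $v\in V(G)$, $f(\sigma_1(v))=f(\sigma_2(v))=\dots=f(\sigma_k(v))$. The $k$-labeled packing number $\lambda^k(G)$ is the largest $p$ such that a $p$-labeled packing of $k$ copies of $G$ into $K_n$ exists (with $n=|V(G)|$). -}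

module Defs where

open import Data.Nat using (ℕ; suc; _+_; _%_; NonZero)
open import Data.Fin using (Fin; toℕ)
open import Data.Product using (Σ; ∃; _×_)
open import Data.Sum using (_⊎_)
open import Relation.Binary.PropositionalEquality using (_≡_; _≢_)
open import Function.Definitions using (Injective; Surjective)
open import Data.Empty using (⊥)

-- A graph on vertex set Fin n, given by its (symmetric, irreflexive) adjacency relation.
Graph : ℕ → Set₁
Graph n = Fin n → Fin n → Set

-- The cycle C_n on vertices 0,…,n-1: i ~ j iff j ≡ i+1 (mod n) or i ≡ j+1 (mod n).
-- (Meaningful as a simple cycle for n ≥ 3.)
Cycle : (n : ℕ) → .{{NonZero n}} → Graph n
Cycle n u v = (toℕ v ≡ (toℕ u + 1) % n) ⊎ (toℕ u ≡ (toℕ v + 1) % n)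

SameEdgeImage : {n : ℕ} → (Fin n → Fin n) → (Fin n → Fin n) →
                Fin n → Fin n → Fin n → Fin n → Set
SameEdgeImage σ τ u v u' v' =
  ((σ u ≡ τ u') × (σ v ≡ τ v')) ⊎ ((σ u ≡ τ v') × (σ v ≡ τ u'))

record LabeledPacking (n : ℕ) (G : Graph n) (k p : ℕ) : Set where
  field
    label      : Fin n → Fin p
    label-onto : Surjective _≡_ _≡_ label
    emb        : Fin k → Fin n → Fin n
    emb-inj    : ∀ i → Injective _≡_ _≡_ (emb i)
    disjoint   : ∀ i j → i ≢ j → ∀ u v u' v' → G u v → G u' v' →
                 SameEdgeImage (emb i) (emb j) u v u' v' → ⊥
    labels-agree : ∀ i j (v : Fin n) → label (emb i v) ≡ label (emb j v)

-- λ^k(G) ≥ m : some p ≥ m admits a p-labeled packing of k copies of G into K_n.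
-- (λ^k(G) is the maximum such p; it exists as p ≤ n.)
LambdaAtLeast : (n : ℕ) → Graph n → (k m : ℕ) → Set
LambdaAtLeast n G k m = Σ ℕ (λ p → (m Data.Nat.≤ p) × LabeledPacking n G k p)

-- All k copies are rotations of one base Hamiltonian cycle by a cyclic group acting on the
-- vertices, so any labelling constant on orbits is shared by the copies, and two copies share an
-- edge only if two base edges lie in one orbit of the action on edges, or a base edge is fixed by
-- a non-trivial rotation.
--
-- For x = 1 the vertices are ℤ₂ₖ and a centre ∞, the base cycle is the zigzag
-- ∞, 0, 2k − 1, 1, 2k − 2, …, k, ∞, and copy i adds (1 + ck)i for a fixed c ∈ {0, 1}.  The sum
-- of the two ends of an edge (∞ counting as the other end) moves by 2i, while the base edges
-- have sums ≡ 0 or −1, so each sum occurs in one copy only.  The labels are {∞} and ℤ₂ₖ; for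
-- odd k the choice c = 1 makes the rotation preserve parity, which splits ℤ₂ₖ into two labels.
--
-- For x ≥ 2 the vertices are two copies A, B of ℤₖ, rotated together, and x fixed hubs, each
-- hub with a label of its own.  The base cycle zigzags through L points of A and then through L
-- points of B, which uses each chord length below L once on either side; continues with crossing
-- edges from A to B whose differences are distinct modulo k; and visits every hub between an
-- A-point and a B-point, so that the edges at a hub are never rotated onto each other.

module Submission where

open import Defs
open import Data.Bool using (true; false; if_then_else_; _∧_)
open import Data.Empty using (⊥; ⊥-elim)
open import Data.Fin using (Fin; toℕ; fromℕ<)
open import Data.Fin.Properties using (toℕ-injective; toℕ<n; toℕ-fromℕ<)
open import Data.Nat
open import Data.Nat.DivMod
open import Data.Nat.Divisibility using (_∣_; divides; ∣⇒≤; ∣m⇒∣m*n; 1∣_)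
open import Data.Nat.Properties
open import Data.Nat.Tactic.RingSolver using (solve-∀)
open import Data.Product using (Σ; ∃; ∃₂; _×_; _,_; proj₁; proj₂)
open import Data.Sum using (_⊎_; inj₁; inj₂)
open import Data.Unit using (⊤; tt)
open import Function using (_∘_)
open import Relation.Binary.Definitions using (tri<; tri≈; tri>)
open import Relation.Binary.PropositionalEquality
open import Relation.Binary.Structures using (IsEquivalence)
open import Relation.Nullary using (yes; no)

infix 4 _≡_[mod_]
_≡_[mod_] : ℕ → ℕ → ℕ → Set
a ≡ b [mod M ] = ∃₂ λ q q′ → a + q * M ≡ b + q′ * M

module _ {M : ℕ} where

  mod-refl : ∀ {a} → a ≡ a [mod M ]
  mod-refl = 0 , 0 , refl

  mod-reflexive : ∀ {a b} → a ≡ b → a ≡ b [mod M ]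
  mod-reflexive refl = mod-refl

  mod-sym : ∀ {a b} → a ≡ b [mod M ] → b ≡ a [mod M ]
  mod-sym (q , q′ , eq) = q′ , q , sym eq

  +-mod-cong : ∀ {a b c d} → a ≡ b [mod M ] → c ≡ d [mod M ] → a + c ≡ b + d [mod M ]
  +-mod-cong {a} {b} {c} {d} (q₁ , q₁′ , eq₁) (q₂ , q₂′ , eq₂) = q₁ + q₂ , q₁′ + q₂′ , (begin
    a + c + (q₁ + q₂) * M         ≡⟨ interchange a c q₁ q₂ M ⟩
    (a + q₁ * M) + (c + q₂ * M)   ≡⟨ cong₂ _+_ eq₁ eq₂ ⟩
    (b + q₁′ * M) + (d + q₂′ * M) ≡⟨ interchange b d q₁′ q₂′ M ⟨
    b + d + (q₁′ + q₂′) * M       ∎)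
    where
    open ≡-Reasoning
    interchange : ∀ a c q r M → a + c + (q + r) * M ≡ (a + q * M) + (c + r * M)
    interchange = solve-∀

  +-mod-cancelʳ : ∀ c {a b} → a + c ≡ b + c [mod M ] → a ≡ b [mod M ]
  +-mod-cancelʳ c {a} {b} (q , q′ , eq) = q , q′ , +-cancelʳ-≡ c _ _ (begin
    a + q * M + c  ≡⟨ swap a (q * M) c ⟩
    a + c + q * M  ≡⟨ eq ⟩
    b + c + q′ * M ≡⟨ swap b (q′ * M) c ⟨
    b + q′ * M + c ∎)
    where
    open ≡-Reasoning
    swap : ∀ a m c → a + m + c ≡ a + c + m
    swap = solve-∀

  +-mod-cancelˡ : ∀ c {a b} → c + a ≡ c + b [mod M ] → a ≡ b [mod M ]
  +-mod-cancelˡ c {a} {b} = +-mod-cancelʳ c ∘ subst₂ (_≡_[mod M ]) (+-comm c a) (+-comm c b)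

  mod-trans : ∀ {a b c} → a ≡ b [mod M ] → b ≡ c [mod M ] → a ≡ c [mod M ]
  mod-trans {a} {b} ab bc = +-mod-cancelʳ b (subst₂ (_≡_[mod M ]) refl (+-comm b _) (+-mod-cong ab bc))

  mod-subtract : ∀ {a b c d i j} → a + i ≡ b + j [mod M ] → c + i ≡ d + j [mod M ] →
                 a + d ≡ b + c [mod M ]
  mod-subtract {a} {b} {c} {d} {i} {j} h₁ h₂ =
    +-mod-cancelʳ (i + j) (subst₂ (_≡_[mod M ]) (regroup a i d j) (regroup′ b j c i) (+-mod-cong h₁ (mod-sym h₂)))
    where
    regroup : ∀ a i d j → (a + i) + (d + j) ≡ (a + d) + (i + j)
    regroup = solve-∀
    regroup′ : ∀ b j c i → (b + j) + (c + i) ≡ (b + c) + (i + j)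
    regroup′ = solve-∀

  mod-self : ∀ a → M + a ≡ a [mod M ]
  mod-self a = 0 , 1 , trans (+-identityʳ (M + a)) (trans (+-comm M a) (cong (a +_) (sym (*-identityˡ M))))

module _ {M : ℕ} .{{_ : NonZero M}} where

  %-mod : ∀ a → a % M ≡ a [mod M ]
  %-mod a = a / M , 0 , trans (sym (m≡m%n+[m/n]*n a M)) (sym (+-identityʳ a))

  %≡%⇒mod : ∀ {a b} → a % M ≡ b % M → a ≡ b [mod M ]
  %≡%⇒mod {a} {b} eq = mod-trans (mod-sym (%-mod a)) (mod-trans (mod-reflexive eq) (%-mod b))

  mod⇒%≡% : ∀ {a b} → a ≡ b [mod M ] → a % M ≡ b % M
  mod⇒%≡% {a} {b} (q , q′ , eq) = begin
    a % M            ≡⟨ [m+kn]%n≡m%n a q M ⟨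
    (a + q * M) % M  ≡⟨ cong (_% M) eq ⟩
    (b + q′ * M) % M ≡⟨ [m+kn]%n≡m%n b q′ M ⟩
    b % M            ∎
    where open ≡-Reasoning

<-mod⇒≡ : ∀ {M a b} → a < M → b < M → a ≡ b [mod M ] → a ≡ b
<-mod⇒≡ {suc _} {a} {b} a<M b<M a≡b = begin
  a     ≡⟨ m<n⇒m%n≡m a<M ⟨
  a % _ ≡⟨ mod⇒%≡% a≡b ⟩
  b % _ ≡⟨ m<n⇒m%n≡m b<M ⟩
  b     ∎
  where open ≡-Reasoning

window-mod⇒≡ : ∀ {M lo a b} → lo ≤ a → lo ≤ b → a < lo + M → b < lo + M → a ≡ b [mod M ] → a ≡ b
window-mod⇒≡ {M} {lo} {a} {b} lo≤a lo≤b a<lo+M b<lo+M a≡b = begin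
  a              ≡⟨ m+[n∸m]≡n lo≤a ⟨
  lo + (a ∸ lo)  ≡⟨ cong (lo +_) (<-mod⇒≡ (offset< lo≤a a<lo+M) (offset< lo≤b b<lo+M) offsets≡) ⟩
  lo + (b ∸ lo)  ≡⟨ m+[n∸m]≡n lo≤b ⟩
  b              ∎
  where
  open ≡-Reasoning
  offset< : ∀ {c} → lo ≤ c → c < lo + M → c ∸ lo < M
  offset< {c} lo≤c c<lo+M = subst (c ∸ lo <_) (m+n∸m≡n lo M) (∸-monoˡ-< c<lo+M lo≤c)
  offsets≡ : a ∸ lo ≡ b ∸ lo [mod M ]
  offsets≡ = +-mod-cancelˡ lo (subst₂ (_≡_[mod M ]) (sym (m+[n∸m]≡n lo≤a)) (sym (m+[n∸m]≡n lo≤b)) a≡b)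

+-double-injective : ∀ {a b} → a + a ≡ b + b → a ≡ b
+-double-injective {a} {b} eq = trans (n≡⌊n+n/2⌋ a) (trans (cong ⌊_/2⌋ eq) (sym (n≡⌊n+n/2⌋ b)))

odd≢even : ∀ a b → suc (a + a) ≢ b + b
odd≢even a b eq = 1+n≢n (trans 1+a≡b (sym a≡b))
  where
  a≡b : a ≡ b
  a≡b = trans (n≡⌈n+n/2⌉ a) (trans (cong ⌊_/2⌋ eq) (sym (n≡⌊n+n/2⌋ b)))
  1+a≡b : suc a ≡ b
  1+a≡b = trans (cong suc (n≡⌊n+n/2⌋ a)) (trans (cong ⌈_/2⌉ eq) (sym (n≡⌈n+n/2⌉ b)))

odd≢even-mod : ∀ {M} a b → suc (a + a) ≡ b + b [mod M + M ] → ⊥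
odd≢even-mod {M} a b (q , q′ , eq) = odd≢even (a + q * M) (b + q′ * M) (begin
  suc ((a + q * M) + (a + q * M))  ≡⟨ double-shift 1 a q M ⟩
  suc (a + a) + q * (M + M)        ≡⟨ eq ⟩
  b + b + q′ * (M + M)             ≡⟨ double-shift 0 b q′ M ⟨
  (b + q′ * M) + (b + q′ * M)      ∎)
  where
  open ≡-Reasoning
  double-shift : ∀ c a q M → c + ((a + q * M) + (a + q * M)) ≡ c + (a + a) + q * (M + M)
  double-shift = solve-∀

+-double-< : ∀ {a b} → a + a < b + b → a < b
+-double-< {a} {b} 2a<2b = ≰⇒> λ b≤a → <⇒≱ 2a<2b (+-mono-≤ b≤a b≤a)

+-double-≤-odd : ∀ {a b} → a + a ≤ suc (b + b) → a ≤ b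
+-double-≤-odd {a} {b} 2a≤2b+1 = ≮⇒≥ λ b<a →
  <⇒≱ (≤-reflexive (cong suc (sym (+-suc b b)))) (≤-trans (+-mono-≤ b<a b<a) 2a≤2b+1)

⌊n/2⌋+⌊n/2⌋≤n : ∀ m → ⌊ m /2⌋ + ⌊ m /2⌋ ≤ m
⌊n/2⌋+⌊n/2⌋≤n m = ≤-trans (+-monoʳ-≤ ⌊ m /2⌋ (⌊n/2⌋≤⌈n/2⌉ m)) (≤-reflexive (⌊n/2⌋+⌈n/2⌉≡n m))

n≤⌈n/2⌉+⌈n/2⌉ : ∀ m → m ≤ ⌈ m /2⌉ + ⌈ m /2⌉
n≤⌈n/2⌉+⌈n/2⌉ m = ≤-trans (≤-reflexive (sym (⌊n/2⌋+⌈n/2⌉≡n m))) (+-monoˡ-≤ ⌈ m /2⌉ (⌊n/2⌋≤⌈n/2⌉ m))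

n+n≡n*2 : ∀ a → a + a ≡ a * 2
n+n≡n*2 = solve-∀

[n+n]%2≡0 : ∀ a → (a + a) % 2 ≡ 0
[n+n]%2≡0 a = trans (cong (_% 2) (n+n≡n*2 a)) (m*n%n≡0 a 2)

[1+n+n]%2≡1 : ∀ a → suc (a + a) % 2 ≡ 1
[1+n+n]%2≡1 a = trans (cong (λ c → suc c % 2) (n+n≡n*2 a)) ([m+kn]%n≡m%n 1 a 2)

∸-split : ∀ {L} a b → a + b ≤ L → L ∸ a ≡ b + (L ∸ (a + b))
∸-split {L} a b a+b≤L = begin
  L ∸ a                         ≡⟨ cong (_∸ a) (m+[n∸m]≡n a+b≤L) ⟨
  (a + b + (L ∸ (a + b))) ∸ a   ≡⟨ cong (_∸ a) (+-assoc a b _) ⟩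
  (a + (b + (L ∸ (a + b)))) ∸ a ≡⟨ m+n∸m≡n a _ ⟩
  b + (L ∸ (a + b))             ∎
  where open ≡-Reasoning

∸-suc : ∀ {a b} → b < a → a ∸ b ≡ suc (a ∸ suc b)
∸-suc {suc a} {zero}  _         = refl
∸-suc {suc a} {suc b} (s≤s b<a) = ∸-suc b<a

if-< : ∀ {A : Set} {a b} {x y : A} → a < b → (if a <ᵇ b then x else y) ≡ x
if-< {a = a} {b} a<b with a <ᵇ b | <⇒<ᵇ a<b
... | true  | _  = refl
... | false | ()

if-≥ : ∀ {A : Set} {a b} {x y : A} → b ≤ a → (if a <ᵇ b then x else y) ≡ y
if-≥ {a = a} {b} b≤a with a <ᵇ b | <ᵇ⇒< a b
... | true  | a<b = ⊥-elim (<⇒≱ (a<b tt) b≤a)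
... | false | _   = refl

data Halves : ℕ → Set where
  even : ∀ a → Halves (a + a)
  odd  : ∀ a → Halves (suc (a + a))

halves : ∀ n → Halves n
halves zero          = even 0
halves (suc zero)    = odd 0
halves (suc (suc n)) with halves n
... | even a = subst Halves (cong suc (+-suc a a)) (even (suc a))
... | odd a  = subst Halves (cong (suc ∘ suc) (+-suc a a)) (odd (suc a))

interleave : {A : Set} → (ℕ → A) → (ℕ → A) → ℕ → A
interleave f g zero          = f zero
interleave f g (suc zero)    = g zero
interleave f g (suc (suc n)) = interleave (f ∘ suc) (g ∘ suc) n

interleave-even : ∀ {A : Set} (f g : ℕ → A) a → interleave f g (a + a) ≡ f a
interleave-even f g zero = refl
interleave-even f g (suc a) rewrite +-suc a a = interleave-even (f ∘ suc) (g ∘ suc) a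

interleave-odd : ∀ {A : Set} (f g : ℕ → A) a → interleave f g (suc (a + a)) ≡ g a
interleave-odd f g zero = refl
interleave-odd f g (suc a) rewrite +-suc a a = interleave-odd (f ∘ suc) (g ∘ suc) a

SameEdge : {A : Set} → (A → A → Set) → A × A → A × A → Set
SameEdge _≈_ (a , b) (c , d) = (a ≈ c × b ≈ d) ⊎ (a ≈ d × b ≈ c)

module _ {A : Set} {_≈_ : A → A → Set} (≈-equiv : IsEquivalence _≈_) where

  open IsEquivalence ≈-equiv renaming (sym to ≈-sym; trans to ≈-trans)

  SameEdge-sym : ∀ {a b c d} → SameEdge _≈_ (a , b) (c , d) → SameEdge _≈_ (c , d) (a , b)
  SameEdge-sym (inj₁ (p , q)) = inj₁ (≈-sym p , ≈-sym q)
  SameEdge-sym (inj₂ (p , q)) = inj₂ (≈-sym q , ≈-sym p)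

  SameEdge-trans : ∀ {a b c d e f} →
                   SameEdge _≈_ (a , b) (c , d) → SameEdge _≈_ (c , d) (e , f) → SameEdge _≈_ (a , b) (e , f)
  SameEdge-trans (inj₁ (p , q)) (inj₁ (r , s)) = inj₁ (≈-trans p r , ≈-trans q s)
  SameEdge-trans (inj₁ (p , q)) (inj₂ (r , s)) = inj₂ (≈-trans p r , ≈-trans q s)
  SameEdge-trans (inj₂ (p , q)) (inj₁ (r , s)) = inj₂ (≈-trans p s , ≈-trans q r)
  SameEdge-trans (inj₂ (p , q)) (inj₂ (r , s)) = inj₁ (≈-trans p s , ≈-trans q r)

SameEdge-map : ∀ {A B : Set} {_≈_ : A → A → Set} {_∼_ : B → B → Set} (f : A → B) →
               (∀ {a b} → a ≈ b → f a ∼ f b) →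
               ∀ {a b c d} → SameEdge _≈_ (a , b) (c , d) → SameEdge _∼_ (f a , f b) (f c , f d)
SameEdge-map f f-pres (inj₁ (p , q)) = inj₁ (f-pres p , f-pres q)
SameEdge-map f f-pres (inj₂ (p , q)) = inj₂ (f-pres p , f-pres q)

SameEdge-cong : ∀ {A B : Set} (f : A → B) {a b c d} →
                SameEdge _≡_ (a , b) (c , d) → SameEdge _≡_ (f a , f b) (f c , f d)
SameEdge-cong f = SameEdge-map {_≈_ = _≡_} {_∼_ = _≡_} f (cong f)

SameEdge⇒symmetric≡ : ∀ {A B : Set} (f : A → A → B) → (∀ a b → f a b ≡ f b a) →
                      ∀ {a b c d} → SameEdge _≡_ (a , b) (c , d) → f a b ≡ f c d
SameEdge⇒symmetric≡ f f-comm (inj₁ (refl , refl)) = refl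
SameEdge⇒symmetric≡ f f-comm (inj₂ (refl , refl)) = f-comm _ _

zigzag : ℕ → ℕ → ℕ
zigzag L = interleave (λ a → a) (λ a → L ∸ suc a)

module _ {L : ℕ} where

  zigzag-even : ∀ a → zigzag L (a + a) ≡ a
  zigzag-even = interleave-even _ _

  zigzag-odd : ∀ a → zigzag L (suc (a + a)) ≡ L ∸ suc a
  zigzag-odd = interleave-odd _ _

  zigzag-< : ∀ {t} → t < L → zigzag L t < L
  zigzag-< {t} t<L with halves t
  ... | even a rewrite zigzag-even a = ≤-<-trans (m≤m+n a a) t<L
  ... | odd a  rewrite zigzag-odd a  = ∸-monoʳ-< z<s (≤-trans (s≤s (m≤m+n a a)) (<⇒≤ t<L))

  zigzag-even≢odd : ∀ {a b} → a + a < L → suc (b + b) < L → a ≢ L ∸ suc b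
  zigzag-even≢odd {a} {b} 2a<L 2b+1<L a≡ = <⇒≱ b<a a≤b
    where
    L≡ : L ≡ a + suc b
    L≡ = trans (sym (m∸n+n≡m (≤-trans (s≤s (m≤m+n b b)) (<⇒≤ 2b+1<L)))) (cong (_+ suc b) (sym a≡))
    a≤b : a ≤ b
    a≤b = s≤s⁻¹ (+-cancelˡ-< a a (suc b) (subst (a + a <_) L≡ 2a<L))
    b<a : b < a
    b<a = +-cancelʳ-< b b a (s≤s⁻¹ (subst (suc (b + b) <_) (trans L≡ (+-suc a b)) 2b+1<L))

  zigzag-injective : ∀ {t t′} → t < L → t′ < L → zigzag L t ≡ zigzag L t′ → t ≡ t′
  zigzag-injective {t} {t′} t<L t′<L eq with halves t | halves t′
  ... | even a | even b = cong (λ c → c + c) (trans (sym (zigzag-even a)) (trans eq (zigzag-even b)))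
  ... | odd a  | odd b  = cong (λ c → suc (c + c)) (suc-injective (∸-cancelˡ-≡
        (≤-trans (s≤s (m≤m+n a a)) (<⇒≤ t<L)) (≤-trans (s≤s (m≤m+n b b)) (<⇒≤ t′<L))
        (trans (sym (zigzag-odd a)) (trans eq (zigzag-odd b)))))
  ... | even a | odd b  =
        ⊥-elim (zigzag-even≢odd t<L t′<L (trans (sym (zigzag-even a)) (trans eq (zigzag-odd b))))
  ... | odd a  | even b =
        ⊥-elim (zigzag-even≢odd t′<L t<L (trans (sym (zigzag-even b)) (trans (sym eq) (zigzag-odd a))))

  zigzag-adjacent : ∀ {t} → suc t < L →
    SameEdge _≡_ (zigzag L t , zigzag L (suc t)) (⌈ t /2⌉ , ⌈ t /2⌉ + (L ∸ suc t))
  zigzag-adjacent {t} t+1<L with halves t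
  ... | even a = inj₁ (trans (zigzag-even a) (n≡⌈n+n/2⌉ a) , (begin
    zigzag L (suc (a + a))            ≡⟨ zigzag-odd a ⟩
    L ∸ suc a                         ≡⟨ ∸-split (suc a) a (<⇒≤ t+1<L) ⟩
    a + (L ∸ suc (a + a))             ≡⟨ cong (_+ (L ∸ suc (a + a))) (n≡⌈n+n/2⌉ a) ⟩
    ⌈ a + a /2⌉ + (L ∸ suc (a + a))   ∎))
    where open ≡-Reasoning
  ... | odd a = inj₂ (first-end , second-end)
    where
    open ≡-Reasoning
    2a+2≡ : suc a + suc a ≡ suc (suc (a + a))
    2a+2≡ = cong suc (+-suc a a)
    first-end : zigzag L (suc (a + a)) ≡ ⌈ suc (a + a) /2⌉ + (L ∸ suc (suc (a + a)))
    first-end = begin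
      zigzag L (suc (a + a))                   ≡⟨ zigzag-odd a ⟩
      L ∸ suc a                                ≡⟨ ∸-split (suc a) (suc a) (subst (_≤ L) (sym 2a+2≡) (<⇒≤ t+1<L)) ⟩
      suc a + (L ∸ (suc a + suc a))            ≡⟨ cong₂ (λ c d → suc c + (L ∸ d)) (n≡⌊n+n/2⌋ a) 2a+2≡ ⟩
      ⌈ suc (a + a) /2⌉ + (L ∸ suc (suc (a + a))) ∎
    second-end : zigzag L (suc (suc (a + a))) ≡ ⌈ suc (a + a) /2⌉
    second-end = begin
      zigzag L (suc (suc (a + a))) ≡⟨ cong (zigzag L) 2a+2≡ ⟨
      zigzag L (suc a + suc a)     ≡⟨ zigzag-even (suc a) ⟩
      suc a                        ≡⟨ cong suc (n≡⌊n+n/2⌋ a) ⟩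
      ⌈ suc (a + a) /2⌉            ∎

  zigzag-adjacent-sum : ∀ {t} → suc t < L →
    (suc (zigzag L t + zigzag L (suc t)) ≡ L) ⊎ (zigzag L t + zigzag L (suc t) ≡ L)
  zigzag-adjacent-sum {t} t+1<L with halves t
  ... | even a = inj₁ (begin
    suc (zigzag L (a + a) + zigzag L (suc (a + a))) ≡⟨ cong₂ (λ c d → suc (c + d)) (zigzag-even a) (zigzag-odd a) ⟩
    suc a + (L ∸ suc a)                             ≡⟨ m+[n∸m]≡n (≤-trans (s≤s (m≤m+n a a)) (<⇒≤ t+1<L)) ⟩
    L                                               ∎)
    where open ≡-Reasoning
  ... | odd a = inj₂ (begin
    zigzag L (suc (a + a)) + zigzag L (suc (suc (a + a))) ≡⟨ cong₂ _+_ (zigzag-odd a) last ⟩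
    L ∸ suc a + suc a                                     ≡⟨ m∸n+n≡m (≤-trans (s≤s (m≤m+n a a)) (<⇒≤ (<-trans (n<1+n _) t+1<L))) ⟩
    L                                                     ∎)
    where
    open ≡-Reasoning
    last : zigzag L (suc (suc (a + a))) ≡ suc a
    last = trans (cong (zigzag L) (sym (cong suc (+-suc a a)))) (zigzag-even (suc a))

module _ {k : ℕ} where

  shift-injective : ∀ {c i j} → i < k → j < k → c + i ≡ c + j [mod k ] → i ≡ j
  shift-injective {c} i<k j<k = <-mod⇒≡ i<k j<k ∘ +-mod-cancelˡ c

  chord-length : ∀ {a a′ d d′ i j} → d < k → d′ < k →
                 a + i ≡ a′ + j [mod k ] → a + d + i ≡ a′ + d′ + j [mod k ] → d ≡ d′
  chord-length {a} {a′} {d} {d′} d<k d′<k h₁ h₂ = sym (<-mod⇒≡ d′<k d<k (+-mod-cancelˡ (a + a′)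
    (subst₂ (_≡_[mod k ]) (regroup a a′ d′) (regroup′ a a′ d) (mod-subtract {k} {a} {a′} {a + d} {a′ + d′} h₁ h₂))))
    where
    regroup : ∀ a a′ d′ → a + (a′ + d′) ≡ (a + a′) + d′
    regroup = solve-∀
    regroup′ : ∀ a a′ d → a′ + (a + d) ≡ (a + a′) + d
    regroup′ = solve-∀

  -- Matching a chord of length d with one of length d′ run in the opposite direction forces
  -- d + d′ ≡ 0 modulo k.
  chord-not-reversed : ∀ {a a′ d d′ i j} → 0 < d → d + d′ < k →
                       a + i ≡ a′ + d′ + j [mod k ] → a + d + i ≡ a′ + j [mod k ] → ⊥
  chord-not-reversed {a} {a′} {d} {d′} 0<d d+d′<k h₁ h₂ = <⇒≢ (<-≤-trans 0<d (m≤m+n d d′))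
    (<-mod⇒≡ (≤-<-trans z≤n d+d′<k) d+d′<k (+-mod-cancelˡ (a + a′)
      (subst₂ (_≡_[mod k ]) (regroup a a′) (regroup′ a a′ d d′) (mod-subtract {k} {a} {a′ + d′} {a + d} {a′} h₁ h₂))))
    where
    regroup : ∀ a a′ → a + a′ ≡ (a + a′) + 0
    regroup = solve-∀
    regroup′ : ∀ a a′ d d′ → a′ + d′ + (a + d) ≡ (a + a′) + (d + d′)
    regroup′ = solve-∀

successor-mod : ∀ {n e} .{{_ : NonZero n}} → suc e < n → (e + 1) % n ≡ suc e
successor-mod {n} {e} e+1<n = trans (cong (_% n) (+-comm e 1)) (m<n⇒m%n≡m e+1<n)

suc-mod-cases : ∀ {n e} .{{_ : NonZero n}} → e < n →
                (suc e < n × (e + 1) % n ≡ suc e) ⊎ (suc e ≡ n × (e + 1) % n ≡ 0)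
suc-mod-cases {n} {e} e<n with m≤n⇒m<n∨m≡n e<n
... | inj₁ e+1<n = inj₁ (e+1<n , successor-mod e+1<n)
... | inj₂ e+1≡n = inj₂ (e+1≡n , trans (cong (_% n) (trans (+-comm e 1) e+1≡n)) (n%n≡0 n))

-- copy i e is the vertex of Kₙ onto which the i-th copy maps the vertex e of Cₙ.
record CycleCopies (n k : ℕ) .{{_ : NonZero n}} : Set where
  field
    copy                 : ℕ → ℕ → ℕ
    copy-<               : ∀ i {e} → e < n → copy i e < n
    copy-injective       : ∀ i {e e′} → e < n → e′ < n → copy i e ≡ copy i e′ → e ≡ e′
    copies-edge-disjoint : ∀ {i j e e′} → i < k → j < k → e < n → e′ < n →
                           SameEdge _≡_ (copy i e , copy i ((e + 1) % n)) (copy j e′ , copy j ((e′ + 1) % n)) →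
                           i ≡ j

record InvariantLabelling (n p : ℕ) (copy : ℕ → ℕ → ℕ) : Set where
  field
    label            : ℕ → ℕ
    label-<          : ∀ {v} → v < n → label v < p
    label-surjective : ∀ {l} → l < p → ∃ λ v → v < n × label v ≡ l
    label-invariant  : ∀ i j e → label (copy i e) ≡ label (copy j e)

module _ {n k p : ℕ} .{{_ : NonZero n}} (C : CycleCopies n k)
         (ℓ : InvariantLabelling n p (CycleCopies.copy C)) where

  open CycleCopies C
  open InvariantLabelling ℓ

  embedding : Fin k → Fin n → Fin n
  embedding i v = fromℕ< (copy-< (toℕ i) (toℕ<n v))

  labelling : Fin n → Fin p
  labelling v = fromℕ< (label-< (toℕ<n v))

  toℕ-embedding : ∀ i v → toℕ (embedding i v) ≡ copy (toℕ i) (toℕ v)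
  toℕ-embedding i v = toℕ-fromℕ< _

  toℕ-labelling : ∀ v → toℕ (labelling v) ≡ label (toℕ v)
  toℕ-labelling v = toℕ-fromℕ< _

  cycle-edge : ∀ {u v} → Cycle n u v → ∃ λ e → e < n × SameEdge _≡_ (e , (e + 1) % n) (toℕ u , toℕ v)
  cycle-edge {u}     (inj₁ v≡u+1) = toℕ u , toℕ<n u , inj₁ (refl , sym v≡u+1)
  cycle-edge {v = v} (inj₂ u≡v+1) = toℕ v , toℕ<n v , inj₂ (refl , sym u≡v+1)

  embedded-edge : ∀ i {u v} → Cycle n u v → ∃ λ e → e < n ×
    SameEdge _≡_ (copy (toℕ i) e , copy (toℕ i) ((e + 1) % n)) (toℕ (embedding i u) , toℕ (embedding i v))
  embedded-edge i uv with cycle-edge uv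
  ... | e , e<n , same = e , e<n , SameEdge-trans isEquivalence (SameEdge-cong (copy (toℕ i)) same)
                                     (inj₁ (sym (toℕ-embedding i _) , sym (toℕ-embedding i _)))

  labelledPacking : LabeledPacking n (Cycle n) k p
  labelledPacking = record
    { label        = labelling
    ; label-onto   = onto
    ; emb          = embedding
    ; emb-inj      = λ i eq → toℕ-injective (copy-injective (toℕ i) (toℕ<n _) (toℕ<n _)
                       (trans (sym (toℕ-embedding i _)) (trans (cong toℕ eq) (toℕ-embedding i _))))
    ; disjoint     = disjoint
    ; labels-agree = λ i j v → toℕ-injective (begin
        toℕ (labelling (embedding i v))   ≡⟨ toℕ-labelling _ ⟩
        label (toℕ (embedding i v))       ≡⟨ cong label (toℕ-embedding i v) ⟩
        label (copy (toℕ i) (toℕ v))      ≡⟨ label-invariant (toℕ i) (toℕ j) (toℕ v) ⟩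
        label (copy (toℕ j) (toℕ v))      ≡⟨ cong label (toℕ-embedding j v) ⟨
        label (toℕ (embedding j v))       ≡⟨ toℕ-labelling _ ⟨
        toℕ (labelling (embedding j v))   ∎)
    }
    where
    open ≡-Reasoning
    disjoint : ∀ i j → i ≢ j → ∀ u v u′ v′ → Cycle n u v → Cycle n u′ v′ →
               SameEdgeImage (embedding i) (embedding j) u v u′ v′ → ⊥
    disjoint i j i≢j u v u′ v′ uv u′v′ same with embedded-edge i uv | embedded-edge j u′v′
    ... | e , e<n , p | e′ , e′<n , p′ = i≢j (toℕ-injective (copies-edge-disjoint (toℕ<n i) (toℕ<n j) e<n e′<n
          (SameEdge-trans isEquivalence p (SameEdge-trans isEquivalence (SameEdge-cong toℕ same) (SameEdge-sym isEquivalence p′)))))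
    onto : ∀ l → ∃ λ v → ∀ {w} → w ≡ v → labelling w ≡ l
    onto l with label-surjective (toℕ<n l)
    ... | v , v<n , lv≡l = fromℕ< v<n , λ { refl → toℕ-injective
          (trans (toℕ-labelling _) (trans (cong label (toℕ-fromℕ< v<n)) lv≡l)) }

λ≥-fromCopies : ∀ {n k p m} .{{_ : NonZero n}} → m ≤ p → (C : CycleCopies n k) →
                InvariantLabelling n p (CycleCopies.copy C) → LambdaAtLeast n (Cycle n) k m
λ≥-fromCopies m≤p C ℓ = _ , m≤p , labelledPacking C ℓ

λ≥-cong : ∀ {n n′ k m} .{nz : NonZero n} .{{_ : NonZero n′}} → n ≡ n′ →
          LambdaAtLeast n (Cycle n ⦃ nz ⦄) k m → LambdaAtLeast n′ (Cycle n′) k m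
λ≥-cong refl λ≥m = λ≥m

-- One extra vertex (x = 1)

module Walecki (k c q : ℕ) .{{_ : NonZero k}} .{{_ : NonZero q}}
               (q∣shift : q ∣ suc (c * k)) (q∣2k : q ∣ k + k) where

  M : ℕ
  M = k + k

  instance
    M-nonZero : NonZero M
    M-nonZero = >-nonZero (≤-trans (>-nonZero⁻¹ k) (m≤m+n k k))

  n : ℕ
  n = suc M

  shift : ℕ → ℕ
  shift i = suc (c * k) * i

  -- Vertex 0 is the centre ∞ and vertex 1 + v is v ∈ ℤ₂ₖ.
  copy : ℕ → ℕ → ℕ
  copy i zero    = zero
  copy i (suc p) = suc ((zigzag M p + shift i) % M)

  -- The sum of the ends of an edge in ℤ₂ₖ, an end at ∞ counting as the other end.
  weight : ℕ → ℕ → ℕ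
  weight zero    zero    = zero
  weight zero    (suc v) = v + v
  weight (suc u) zero    = u + u
  weight (suc u) (suc v) = u + v

  weight-comm : ∀ u v → weight u v ≡ weight v u
  weight-comm zero    zero    = refl
  weight-comm zero    (suc v) = refl
  weight-comm (suc u) zero    = refl
  weight-comm (suc u) (suc v) = +-comm u v

  shift-double : ∀ i → shift i + shift i ≡ i + i [mod M ]
  shift-double i = 0 , c * i , identity c k i
    where
    identity : ∀ c k i → (1 + c * k) * i + (1 + c * k) * i + 0 * (k + k) ≡ i + i + c * i * (k + k)
    identity = solve-∀

  zigzag-last : ∀ {p} → suc p ≡ M → zigzag M p ≡ k
  zigzag-last {p} p+1≡M with halves p
  ... | even a = ⊥-elim (odd≢even a k p+1≡M)
  ... | odd a  = begin
    zigzag M (suc (a + a)) ≡⟨ zigzag-odd {M} a ⟩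
    M ∸ suc a              ≡⟨ cong (M ∸_) 1+a≡k ⟩
    M ∸ k                  ≡⟨ m+n∸n≡m k k ⟩
    k                      ∎
    where
    open ≡-Reasoning
    1+a≡k : suc a ≡ k
    1+a≡k = +-double-injective (trans (cong suc (+-suc a a)) p+1≡M)

  EdgeWeight : ℕ → ℕ → Set
  EdgeWeight i w = (w ≡ i + i [mod M ]) ⊎ (suc w ≡ i + i [mod M ])

  weight-mod : ∀ i a b → (a + shift i) % M + (b + shift i) % M ≡ a + b + (i + i) [mod M ]
  weight-mod i a b = mod-trans (+-mod-cong (%-mod (a + shift i)) (%-mod (b + shift i)))
    (mod-trans (mod-reflexive (regroup a b (shift i))) (+-mod-cong {a = a + b} mod-refl (shift-double i)))
    where
    regroup : ∀ a b s → (a + s) + (b + s) ≡ (a + b) + (s + s)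
    regroup = solve-∀

  M+-mod : ∀ {m} i → m ≡ M → m + (i + i) ≡ i + i [mod M ]
  M+-mod i refl = mod-self (i + i)

  copy-weight : ∀ i {e} → e < n → EdgeWeight i (weight (copy i e) (copy i ((e + 1) % n)))
  copy-weight i {e} e<n with suc-mod-cases e<n
  copy-weight i {zero} _ | inj₁ (_ , next≡1) rewrite next≡1 = inj₁ (weight-mod i 0 0)
  copy-weight i {suc p} _ | inj₁ (p+2<n , next≡) rewrite next≡ with zigzag-adjacent-sum (s≤s⁻¹ p+2<n)
  ... | inj₁ 1+sum≡M = inj₂ (mod-trans (+-mod-cong {a = 1} mod-refl (weight-mod i (zigzag M p) _)) (M+-mod i 1+sum≡M))
  ... | inj₂ sum≡M   = inj₁ (mod-trans (weight-mod i (zigzag M p) _) (M+-mod i sum≡M))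
  copy-weight i {zero} _ | inj₂ (1≡n , _) = ⊥-elim (≢-nonZero⁻¹ M (sym (suc-injective 1≡n)))
  copy-weight i {suc p} _ | inj₂ (p+2≡n , next≡0) rewrite next≡0 | zigzag-last (suc-injective p+2≡n) =
    inj₁ (mod-trans (weight-mod i k k) (mod-self (i + i)))

  copy-< : ∀ i {e} → e < n → copy i e < n
  copy-< i {zero}  _ = z<s
  copy-< i {suc p} _ = s≤s (m%n<n _ M)

  copy-injective : ∀ i {e e′} → e < n → e′ < n → copy i e ≡ copy i e′ → e ≡ e′
  copy-injective i {zero}  {zero}   _ _ _ = refl
  copy-injective i {suc p} {suc p′} (s≤s p<M) (s≤s p′<M) eq =
    cong suc (zigzag-injective p<M p′<M (<-mod⇒≡ (zigzag-< p<M) (zigzag-< p′<M)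
      (+-mod-cancelʳ (shift i) (%≡%⇒mod (suc-injective eq)))))

  copies-edge-disjoint : ∀ {i j e e′} → i < k → j < k → e < n → e′ < n →
    SameEdge _≡_ (copy i e , copy i ((e + 1) % n)) (copy j e′ , copy j ((e′ + 1) % n)) → i ≡ j
  copies-edge-disjoint {i} {j} i<k j<k e<n e′<n same =
    weights-agree (copy-weight i e<n) (copy-weight j e′<n) (SameEdge⇒symmetric≡ weight weight-comm same)
    where
    double-injective : i + i ≡ j + j [mod M ] → i ≡ j
    double-injective = +-double-injective ∘ <-mod⇒≡ (+-mono-< i<k i<k) (+-mono-< j<k j<k)
    weights-agree : ∀ {w w′} → EdgeWeight i w → EdgeWeight j w′ → w ≡ w′ → i ≡ j
    weights-agree (inj₁ p) (inj₁ q) refl = double-injective (mod-trans (mod-sym p) q)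
    weights-agree (inj₂ p) (inj₂ q) refl = double-injective (mod-trans (mod-sym p) q)
    weights-agree (inj₁ p) (inj₂ q) refl = ⊥-elim (odd≢even-mod {k} i j (mod-trans (+-mod-cong {a = 1} mod-refl (mod-sym p)) q))
    weights-agree (inj₂ p) (inj₁ q) refl = ⊥-elim (odd≢even-mod {k} j i (mod-trans (+-mod-cong {a = 1} mod-refl (mod-sym q)) p))

  copies : CycleCopies n k
  copies = record
    { copy = copy ; copy-< = copy-< ; copy-injective = copy-injective
    ; copies-edge-disjoint = copies-edge-disjoint }

  label : ℕ → ℕ
  label zero    = zero
  label (suc v) = suc (v % q)

  label-copy : ∀ i p → label (copy i (suc p)) ≡ suc (zigzag M p % q)
  label-copy i p = cong suc (begin
    (zigzag M p + shift i) % M % q ≡⟨ m∣n⇒o%n%m≡o%m q M _ q∣2k ⟩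
    (zigzag M p + shift i) % q     ≡⟨ %-remove-+ʳ (zigzag M p) (∣m⇒∣m*n i q∣shift) ⟩
    zigzag M p % q                 ∎)
    where open ≡-Reasoning

  labels : InvariantLabelling n (suc q) copy
  labels = record
    { label = label
    ; label-< = λ { {zero} _ → z<s ; {suc v} _ → s≤s (m%n<n v q) }
    ; label-surjective = surjective
    ; label-invariant = invariant }
    where
    surjective : ∀ {l} → l < suc q → ∃ λ v → v < n × label v ≡ l
    surjective {zero}  _         = zero , z<s , refl
    surjective {suc r} (s≤s r<q) = suc r , s≤s (<-≤-trans r<q (∣⇒≤ q∣2k)) , cong suc (m<n⇒m%n≡m r<q)
    invariant : ∀ i j e → label (copy i e) ≡ label (copy j e)
    invariant i j zero    = refl
    invariant i j (suc p) = trans (label-copy i p) (sym (label-copy j p))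

  λ≥ : LambdaAtLeast n (Cycle n) k (suc q)
  λ≥ = λ≥-fromCopies ≤-refl copies labels

-- Fixed hubs (x ≥ 2)

data Side : Set where
  A B : Side

data Point : Set where
  rot : Side → ℕ → Point
  hub : ℕ → Point

rot-injective : ∀ {s s′ c c′} → rot s c ≡ rot s′ c′ → s ≡ s′ × c ≡ c′
rot-injective refl = refl , refl

module _ {p p′ : Point} {s s′ c c′} (p≡ : p ≡ rot s c) (p′≡ : p′ ≡ rot s′ c′) (p≡p′ : p ≡ p′) where

  rot-side : s ≡ s′
  rot-side = proj₁ (rot-injective (trans (sym p≡) (trans p≡p′ p′≡)))

  rot-value : c ≡ c′
  rot-value = proj₂ (rot-injective (trans (sym p≡) (trans p≡p′ p′≡)))

A≢B : A ≢ B
A≢B ()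

module HubCycle (k L x : ℕ) .{{_ : NonZero k}} (1≤L : 1 ≤ L) (2L≤k+1 : L + L ≤ suc k) (2≤x : 2 ≤ x)
                (2L+x≤2k+2 : L + L + x ≤ 2 + (k + k)) (k+2≤2L+x : 2 + k ≤ L + L + x) where

  L≤k : L ≤ k
  L≤k = s≤s⁻¹ (≤-trans (subst (_≤ L + L) (+-comm L 1) (+-monoʳ-≤ L 1≤L)) 2L≤k+1)

  P : ℕ
  P = k + k ∸ x

  n : ℕ
  n = k + k + x

  x≤2k : x ≤ k + k
  x≤2k = +-cancelˡ-≤ 2 x (k + k) (≤-trans (+-monoˡ-≤ x (+-mono-≤ 1≤L 1≤L)) 2L+x≤2k+2)

  P+x≡2k : P + x ≡ k + k
  P+x≡2k = m∸n+n≡m x≤2k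

  P+2+x≡2+2k : P + 2 + x ≡ 2 + (k + k)
  P+2+x≡2+2k = trans (regroup P x) (cong (2 +_) P+x≡2k)
    where
    regroup : ∀ P x → P + 2 + x ≡ 2 + (P + x)
    regroup = solve-∀

  2L≤P+2 : L + L ≤ P + 2
  2L≤P+2 = +-cancelʳ-≤ x (L + L) (P + 2) (subst (L + L + x ≤_) (sym P+2+x≡2+2k) 2L+x≤2k+2)

  P+2≤k+2L : P + 2 ≤ k + (L + L)
  P+2≤k+2L = +-cancelʳ-≤ x (P + 2) (k + (L + L)) (begin
    P + 2 + x         ≡⟨ P+2+x≡2+2k ⟩
    2 + (k + k)       ≡⟨ regroup k ⟩
    k + (2 + k)       ≤⟨ +-monoʳ-≤ k k+2≤2L+x ⟩
    k + (L + L + x)   ≡⟨ +-assoc k (L + L) x ⟨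
    k + (L + L) + x   ∎)
    where
    open ≤-Reasoning
    regroup : ∀ k → 2 + (k + k) ≡ k + (2 + k)
    regroup = solve-∀

  P<2k : P < k + k
  P<2k = subst (P <_) P+x≡2k (m<m+n P (≤-trans (s≤s z≤n) 2≤x))

  L<2L : L < L + L
  L<2L = m<m+n L 1≤L

  L≤P+1 : L ≤ suc P
  L≤P+1 = s≤s⁻¹ (≤-trans L<2L (subst (L + L ≤_) (+-comm P 2) 2L≤P+2))

  n≡P+x+x : n ≡ P + x + x
  n≡P+x+x = cong (_+ x) (sym P+x≡2k)

  instance
    n-nonZero : NonZero n
    n-nonZero = >-nonZero (<-≤-trans (>-nonZero⁻¹ k) (≤-trans (m≤m+n k k) (m≤m+n (k + k) x)))

  L<n : L < n
  L<n = <-≤-trans (≤-<-trans L≤k (m<m+n k (>-nonZero⁻¹ k))) (m≤m+n (k + k) x)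

  P+2<n : P + 2 < n
  P+2<n = subst (P + 2 <_) (sym n≡P+x+x) (≤-<-trans (+-monoʳ-≤ P 2≤x) (m<m+n (P + x) (≤-trans (s≤s z≤n) 2≤x)))

  base : Side → ℕ
  base A = 0
  base B = k ∸ L

  runPoint : Side → ℕ → Point
  runPoint s t = rot s (base s + zigzag L t)

  crossEnd : Side → ℕ → ℕ
  crossEnd A g = ⌈ g /2⌉
  crossEnd B g = k ∸ suc ⌊ g /2⌋

  crossPoint : Side → ℕ → Point
  crossPoint s g = rot s (crossEnd s g)

  -- The order in which the base cycle visits the 2k rotated points: a zigzag through
  -- A 0, …, A (L − 1), a zigzag back through B (k − L), …, B (k − 1), and then alternately
  -- A L, B (k − L − 1), A (L + 1), … , so that from index 2L − 1 on consecutive points cross.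
  w : ℕ → Point
  w g = if g <ᵇ L then runPoint A g
        else if g <ᵇ L + L then runPoint B (L + L ∸ suc g)
        else interleave (rot A) (λ a → rot B (k ∸ suc a)) g

  w-runA : ∀ {g} → g < L → w g ≡ runPoint A g
  w-runA = if-<

  w-runB : ∀ {g} → L ≤ g → g < L + L → w g ≡ runPoint B (L + L ∸ suc g)
  w-runB L≤g g<2L = trans (if-≥ L≤g) (if-< g<2L)

  w-alternating : ∀ {g} → L + L ≤ g → w g ≡ interleave (rot A) (λ a → rot B (k ∸ suc a)) g
  w-alternating 2L≤g = trans (if-≥ (≤-trans (m≤m+n L L) 2L≤g)) (if-≥ 2L≤g)

  w-even : ∀ {a} → L + L ≤ a + a → w (a + a) ≡ rot A a
  w-even {a} 2L≤2a = trans (w-alternating 2L≤2a) (interleave-even _ _ a)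

  w-odd : ∀ {a} → L + L ≤ suc (a + a) → w (suc (a + a)) ≡ rot B (k ∸ suc a)
  w-odd {a} 2L≤2a+1 = trans (w-alternating 2L≤2a+1) (interleave-odd _ _ a)

  data WView : ℕ → Set where
    runA    : ∀ {g} → g < L → w g ≡ runPoint A g → WView g
    runB    : ∀ {g} → L ≤ g → g < L + L → w g ≡ runPoint B (L + L ∸ suc g) → WView g
    altEven : ∀ a → L + L ≤ a + a → w (a + a) ≡ rot A a → WView (a + a)
    altOdd  : ∀ a → L + L ≤ suc (a + a) → w (suc (a + a)) ≡ rot B (k ∸ suc a) → WView (suc (a + a))

  w-view : ∀ g → WView g
  w-view g with g <? L | g <? L + L
  ... | yes g<L | _        = runA g<L (w-runA g<L)
  ... | no g≮L  | yes g<2L = runB (≮⇒≥ g≮L) g<2L (w-runB (≮⇒≥ g≮L) g<2L)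
  ... | no _    | no g≮2L  with halves g
  ...   | even a = altEven a (≮⇒≥ g≮2L) (w-even (≮⇒≥ g≮2L))
  ...   | odd a  = altOdd a (≮⇒≥ g≮2L) (w-odd (≮⇒≥ g≮2L))

  2L∸[1+L]≡L∸1 : L + L ∸ suc L ≡ L ∸ 1
  2L∸[1+L]≡L∸1 = trans (cong (L + L ∸_) (+-comm 1 L)) ([m+n]∸[m+o]≡n∸o L L 1)

  run-index< : ∀ {g} → L ≤ g → L + L ∸ suc g < L
  run-index< L≤g = ≤-<-trans (∸-monoʳ-≤ (L + L) (s≤s L≤g))
                     (subst (_< L) (sym 2L∸[1+L]≡L∸1) (∸-monoʳ-< z<s 1≤L))

  w-cross : ∀ {g} → L + L ≤ suc g → SameEdge _≡_ (w g , w (suc g)) (crossPoint A g , crossPoint B g)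
  w-cross {g} 2L≤g+1 with halves g
  ... | even a = inj₁ (trans (w-even 2L≤2a) (cong (rot A) (n≡⌈n+n/2⌉ a)) ,
                       trans (w-odd 2L≤g+1) (cong (λ c → rot B (k ∸ suc c)) (n≡⌊n+n/2⌋ a)))
    where
    2L≤2a : L + L ≤ a + a
    2L≤2a with m≤n⇒m<n∨m≡n 2L≤g+1
    ... | inj₁ 2L<2a+1 = s≤s⁻¹ 2L<2a+1
    ... | inj₂ 2L≡2a+1 = ⊥-elim (odd≢even a L (sym 2L≡2a+1))
  ... | odd a = inj₂ (side-B , side-A)
    where
    2a+2≡ : suc a + suc a ≡ suc (suc (a + a))
    2a+2≡ = cong suc (+-suc a a)
    side-A : w (suc (suc (a + a))) ≡ crossPoint A (suc (a + a))
    side-A = begin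
      w (suc (suc (a + a)))  ≡⟨ cong w 2a+2≡ ⟨
      w (suc a + suc a)      ≡⟨ w-even (subst (L + L ≤_) (sym 2a+2≡) 2L≤g+1) ⟩
      rot A (suc a)          ≡⟨ cong (rot A ∘ suc) (n≡⌊n+n/2⌋ a) ⟩
      crossPoint A (suc (a + a)) ∎
      where open ≡-Reasoning
    side-B : w (suc (a + a)) ≡ crossPoint B (suc (a + a))
    side-B with m≤n⇒m<n∨m≡n 2L≤g+1
    ... | inj₁ 2L<2a+2 = trans (w-odd (s≤s⁻¹ 2L<2a+2)) (cong (λ c → rot B (k ∸ suc c)) (n≡⌈n+n/2⌉ a))
    ... | inj₂ 2L≡2a+2 = begin
      w (suc (a + a))                                    ≡⟨ w-runB L≤2a+1 (subst (suc (a + a) <_) (sym 2L≡2a+2) ≤-refl) ⟩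
      runPoint B (L + L ∸ suc (suc (a + a)))             ≡⟨ cong (λ m → runPoint B (m ∸ suc (suc (a + a)))) 2L≡2a+2 ⟩
      runPoint B (suc (suc (a + a)) ∸ suc (suc (a + a))) ≡⟨ cong (runPoint B) (n∸n≡0 (suc (suc (a + a)))) ⟩
      rot B (k ∸ L + 0)                                  ≡⟨ cong (rot B) (trans (+-identityʳ _) (cong (k ∸_) L≡a+1)) ⟩
      rot B (k ∸ suc a)                                  ≡⟨ cong (λ c → rot B (k ∸ suc c)) (n≡⌈n+n/2⌉ a) ⟩
      crossPoint B (suc (a + a))                         ∎
      where
      open ≡-Reasoning
      L≡a+1 : L ≡ suc a
      L≡a+1 = +-double-injective (trans 2L≡2a+2 (sym 2a+2≡))
      L≤2a+1 : L ≤ suc (a + a)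
      L≤2a+1 = subst (_≤ suc (a + a)) (sym L≡a+1) (s≤s (m≤m+n a a))

  w-normal : ∀ {g} → g < k + k → ∃₂ λ s c → c < k × w g ≡ rot s c
  w-normal {g} g<2k with w-view g
  ... | runA g<L w≡ = A , _ , <-≤-trans (zigzag-< g<L) L≤k , w≡
  ... | runB L≤g g<2L w≡ = B , _ , subst (k ∸ L + zigzag L (L + L ∸ suc g) <_) (m∸n+n≡m L≤k)
                                      (+-monoʳ-< (k ∸ L) (zigzag-< (run-index< L≤g))) , w≡
  ... | altEven a _ w≡ = A , a , +-double-< g<2k , w≡
  ... | altOdd a _ w≡ = B , k ∸ suc a , ∸-monoʳ-< z<s (+-double-< (<-trans (n<1+n _) g<2k)) , w≡

  zigzag≢alternating : ∀ {t b} → t < L → L + L ≤ b + b → zigzag L t ≢ b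
  zigzag≢alternating t<L 2L≤2b = <⇒≢ (<-≤-trans (zigzag-< t<L) (+-double-≤-odd (≤-trans 2L≤2b (n≤1+n _))))

  runB≢alternating : ∀ {b} z → L + L ≤ suc (b + b) → b < k → k ∸ L + z ≢ k ∸ suc b
  runB≢alternating {b} z 2L≤2b+1 b<k eq =
    <⇒≢ (<-≤-trans (∸-monoʳ-< (s≤s (+-double-≤-odd {L} {b} 2L≤2b+1)) b<k) (m≤m+n (k ∸ L) z)) (sym eq)

  w-injective : ∀ {g g′} → g < k + k → g′ < k + k → w g ≡ w g′ → g ≡ g′
  w-injective {g} {g′} g<2k g′<2k eq with w-view g | w-view g′
  ... | runA g<L e | runA g′<L e′ = zigzag-injective g<L g′<L (rot-value e e′ eq)
  ... | runB L≤g g<2L e | runB L≤g′ g′<2L e′ = suc-injective (∸-cancelˡ-≡ g<2L g′<2L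
        (zigzag-injective (run-index< L≤g) (run-index< L≤g′) (+-cancelˡ-≡ (k ∸ L) _ _ (rot-value e e′ eq))))
  ... | altEven a _ e | altEven b _ e′ = cong (λ c → c + c) (rot-value e e′ eq)
  ... | altOdd a _ e | altOdd b _ e′ = cong (λ c → suc (c + c)) (suc-injective
        (∸-cancelˡ-≡ (+-double-< {a} {k} (<-trans (n<1+n _) g<2k)) (+-double-< {b} {k} (<-trans (n<1+n _) g′<2k))
                      (rot-value e e′ eq)))
  ... | runA g<L e | altEven b 2L≤2b e′ = ⊥-elim (zigzag≢alternating g<L 2L≤2b (rot-value e e′ eq))
  ... | altEven a 2L≤2a e | runA g′<L e′ = ⊥-elim (zigzag≢alternating g′<L 2L≤2a (sym (rot-value e e′ eq)))
  ... | runB _ _ e | altOdd b 2L≤2b+1 e′ =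
        ⊥-elim (runB≢alternating _ 2L≤2b+1 (+-double-< (<-trans (n<1+n _) g′<2k)) (rot-value e e′ eq))
  ... | altOdd a 2L≤2a+1 e | runB _ _ e′ =
        ⊥-elim (runB≢alternating _ 2L≤2a+1 (+-double-< (<-trans (n<1+n _) g<2k)) (sym (rot-value e e′ eq)))
  ... | runA _ e      | runB _ _ e′    = ⊥-elim (A≢B (rot-side e e′ eq))
  ... | runA _ e      | altOdd _ _ e′  = ⊥-elim (A≢B (rot-side e e′ eq))
  ... | altEven _ _ e | runB _ _ e′    = ⊥-elim (A≢B (rot-side e e′ eq))
  ... | altEven _ _ e | altOdd _ _ e′  = ⊥-elim (A≢B (rot-side e e′ eq))
  ... | runB _ _ e    | runA _ e′      = ⊥-elim (A≢B (sym (rot-side e e′ eq)))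
  ... | runB _ _ e    | altEven _ _ e′ = ⊥-elim (A≢B (sym (rot-side e e′ eq)))
  ... | altOdd _ _ e  | runA _ e′      = ⊥-elim (A≢B (sym (rot-side e e′ eq)))
  ... | altOdd _ _ e  | altEven _ _ e′ = ⊥-elim (A≢B (sym (rot-side e e′ eq)))

  offset : Side → ℕ
  offset A = 0
  offset B = k

  vertex : Point → ℕ
  vertex (rot s c) = offset s + c % k
  vertex (hub r)   = k + k + r

  shift : ℕ → Point → Point
  shift i (rot s c) = rot s (c + i)
  shift i (hub r)   = hub r

  infix 4 _≃_
  data _≃_ : Point → Point → Set where
    rot≃ : ∀ {s c c′} → c ≡ c′ [mod k ] → rot s c ≃ rot s c′
    hub≃ : ∀ {r} → hub r ≃ hub r

  ≃-reflexive : ∀ {p q} → p ≡ q → p ≃ q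
  ≃-reflexive {rot s c} refl = rot≃ mod-refl
  ≃-reflexive {hub r}   refl = hub≃

  ≃-isEquivalence : IsEquivalence _≃_
  ≃-isEquivalence = record
    { refl  = ≃-reflexive refl
    ; sym   = λ { (rot≃ c≡c′) → rot≃ (mod-sym c≡c′) ; hub≃ → hub≃ }
    ; trans = λ { (rot≃ c≡c′) (rot≃ c′≡c″) → rot≃ (mod-trans c≡c′ c′≡c″) ; hub≃ hub≃ → hub≃ }
    }

  shift-≃ : ∀ i {p q} → p ≃ q → shift i p ≃ shift i q
  shift-≃ i (rot≃ c≡c′) = rot≃ (+-mod-cong c≡c′ mod-refl)
  shift-≃ i hub≃        = hub≃

  shift-cancel : ∀ i {p q} → shift i p ≃ shift i q → p ≃ q
  shift-cancel i {rot _ _} {rot _ _} (rot≃ h) = rot≃ (+-mod-cancelʳ i h)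
  shift-cancel i {hub _}   {hub _}   hub≃     = hub≃
  shift-cancel i {rot _ _} {hub _}   ()
  shift-cancel i {hub _}   {rot _ _} ()

  vertex-injective : ∀ {p q} → vertex p ≡ vertex q → p ≃ q
  vertex-injective {rot A c} {rot A c′} eq = rot≃ (%≡%⇒mod eq)
  vertex-injective {rot B c} {rot B c′} eq = rot≃ (%≡%⇒mod (+-cancelˡ-≡ k _ _ eq))
  vertex-injective {hub r}   {hub r′}   eq = ≃-reflexive (cong hub (+-cancelˡ-≡ (k + k) _ _ eq))
  vertex-injective {rot A c} {rot B c′} eq = ⊥-elim (<⇒≢ (<-≤-trans (m%n<n c k) (m≤m+n k _)) eq)
  vertex-injective {rot B c} {rot A c′} eq = ⊥-elim (<⇒≢ (<-≤-trans (m%n<n c′ k) (m≤m+n k _)) (sym eq))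
  vertex-injective {rot A c} {hub r′}   eq = ⊥-elim (<⇒≢ (<-≤-trans (m%n<n c k) (≤-trans (m≤m+n k k) (m≤m+n _ r′))) eq)
  vertex-injective {hub r}   {rot A c′} eq = ⊥-elim (<⇒≢ (<-≤-trans (m%n<n c′ k) (≤-trans (m≤m+n k k) (m≤m+n _ r))) (sym eq))
  vertex-injective {rot B c} {hub r′}   eq = ⊥-elim (<⇒≢ (<-≤-trans (+-monoʳ-< k (m%n<n c k)) (m≤m+n _ r′)) eq)
  vertex-injective {hub r}   {rot B c′} eq = ⊥-elim (<⇒≢ (<-≤-trans (+-monoʳ-< k (m%n<n c′ k)) (m≤m+n _ r)) (sym eq))

  data BaseEdge : Set where
    run   : Side → ℕ → BaseEdge
    cross : ℕ → BaseEdge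
    spoke : Side → ℕ → BaseEdge

  -- Hub 0 sits between the two zigzag runs; hub (1 + r) takes the place of the crossing at
  -- index P + 1 + r.
  spokeEnd : Side → ℕ → ℕ
  spokeEnd s zero    = base s + zigzag L (L ∸ 1)
  spokeEnd s (suc r) = crossEnd s (suc P + r)

  ends : BaseEdge → Point × Point
  ends (run s t)   = rot s (base s + ⌈ t /2⌉) , rot s (base s + ⌈ t /2⌉ + (L ∸ suc t))
  ends (cross g)   = crossPoint A g , crossPoint B g
  ends (spoke s r) = hub r , rot s (spokeEnd s r)

  Valid : BaseEdge → Set
  Valid (run s t)   = suc t < L
  Valid (cross g)   = L + L ≤ suc g × g ≤ P
  Valid (spoke s r) = ⊤

  shiftₑ : ℕ → Point × Point → Point × Point
  shiftₑ i (p , q) = shift i p , shift i q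

  run-length< : ∀ {t} → suc t < L → L ∸ suc t < L
  run-length< t+1<L = ∸-monoʳ-< z<s (<⇒≤ t+1<L)

  runs-disjoint : ∀ b {t t′ i j} → suc t < L → suc t′ < L → i < k → j < k →
                  b + ⌈ t /2⌉ + i ≡ b + ⌈ t′ /2⌉ + j [mod k ] →
                  b + ⌈ t /2⌉ + (L ∸ suc t) + i ≡ b + ⌈ t′ /2⌉ + (L ∸ suc t′) + j [mod k ] → i ≡ j
  runs-disjoint b {t} {t′} t+1<L t′+1<L i<k j<k h₁ h₂ =
    shift-injective i<k j<k (subst (λ u → b + ⌈ t /2⌉ + _ ≡ b + ⌈ u /2⌉ + _ [mod k ]) (sym t≡t′) h₁)
    where
    t≡t′ : t ≡ t′
    t≡t′ = suc-injective (∸-cancelˡ-≡ (<⇒≤ t+1<L) (<⇒≤ t′+1<L)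
             (chord-length {k} {b + ⌈ t /2⌉} {b + ⌈ t′ /2⌉}
               (<-≤-trans (run-length< t+1<L) L≤k) (<-≤-trans (run-length< t′+1<L) L≤k) h₁ h₂))

  runs-not-reversed : ∀ b {t t′ i j} → suc t < L → suc t′ < L →
                      b + ⌈ t /2⌉ + i ≡ b + ⌈ t′ /2⌉ + (L ∸ suc t′) + j [mod k ] →
                      b + ⌈ t /2⌉ + (L ∸ suc t) + i ≡ b + ⌈ t′ /2⌉ + j [mod k ] → ⊥
  runs-not-reversed b {t} {t′} t+1<L t′+1<L =
    chord-not-reversed {k} {b + ⌈ t /2⌉} {b + ⌈ t′ /2⌉} (m<n⇒0<n∸m t+1<L) (s≤s⁻¹ (begin
      suc (suc (L ∸ suc t + (L ∸ suc t′))) ≡⟨ cong suc (+-suc _ _) ⟨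
      suc (L ∸ suc t) + suc (L ∸ suc t′)   ≤⟨ +-mono-≤ (run-length< t+1<L) (run-length< t′+1<L) ⟩
      L + L                                ≤⟨ 2L≤k+1 ⟩
      suc k                                ∎))
    where open ≤-Reasoning

  ⌊/2⌋<k : ∀ {g} → g < k + k → ⌊ g /2⌋ < k
  ⌊/2⌋<k {g} g<2k = +-double-< (≤-<-trans (⌊n/2⌋+⌊n/2⌋≤n g) g<2k)

  cross-sum : ∀ {g g′} → g < k + k → g′ < k + k →
              ⌈ g /2⌉ + crossEnd B g′ + (suc ⌊ g /2⌋ + suc ⌊ g′ /2⌋) ≡ suc g + k
  cross-sum {g} {g′} g<2k g′<2k = begin
    ⌈ g /2⌉ + crossEnd B g′ + (suc ⌊ g /2⌋ + suc ⌊ g′ /2⌋)   ≡⟨ regroup ⌈ g /2⌉ (crossEnd B g′) ⌊ g /2⌋ ⌊ g′ /2⌋ ⟩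
    suc (⌈ g /2⌉ + ⌊ g /2⌋) + (crossEnd B g′ + suc ⌊ g′ /2⌋) ≡⟨ cong₂ (λ a b → suc a + b) ⌈g/2⌉+⌊g/2⌋≡g (m∸n+n≡m (⌊/2⌋<k g′<2k)) ⟩
    suc g + k                                               ∎
    where
    open ≡-Reasoning
    regroup : ∀ c K f f′ → c + K + (1 + f + (1 + f′)) ≡ 1 + (c + f) + (K + (1 + f′))
    regroup = solve-∀
    ⌈g/2⌉+⌊g/2⌋≡g : ⌈ g /2⌉ + ⌊ g /2⌋ ≡ g
    ⌈g/2⌉+⌊g/2⌋≡g = trans (+-comm ⌈ g /2⌉ ⌊ g /2⌋) (⌊n/2⌋+⌈n/2⌉≡n g)

  -- The ends of the crossing at index g differ by k − 1 − g modulo k, and the admissible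
  -- indices g lie in a window of length k.
  crosses-disjoint : ∀ {g g′ i j} → L + L ≤ suc g → g ≤ P → L + L ≤ suc g′ → g′ ≤ P → i < k → j < k →
                     ⌈ g /2⌉ + i ≡ ⌈ g′ /2⌉ + j [mod k ] → crossEnd B g + i ≡ crossEnd B g′ + j [mod k ] → i ≡ j
  crosses-disjoint {g} {g′} 2L≤g+1 g≤P 2L≤g′+1 g′≤P i<k j<k h₁ h₂ =
    shift-injective i<k j<k (subst (λ u → ⌈ g /2⌉ + _ ≡ ⌈ u /2⌉ + _ [mod k ]) (sym g≡g′) h₁)
    where
    g<2k : g < k + k
    g<2k = ≤-<-trans g≤P P<2k
    g′<2k : g′ < k + k
    g′<2k = ≤-<-trans g′≤P P<2k
    below-window : ∀ {h} → h ≤ P → suc h < L + L + k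
    below-window {h} h≤P = begin
      suc (suc h)  ≤⟨ s≤s (s≤s h≤P) ⟩
      2 + P        ≡⟨ +-comm 2 P ⟩
      P + 2        ≤⟨ P+2≤k+2L ⟩
      k + (L + L)  ≡⟨ +-comm k (L + L) ⟩
      L + L + k    ∎
      where open ≤-Reasoning
    g+1≡g′+1 : suc g + k ≡ suc g′ + k [mod k ]
    g+1≡g′+1 = subst₂ (_≡_[mod k ]) (cross-sum g<2k g′<2k)
                 (trans (cong (⌈ g′ /2⌉ + crossEnd B g +_) (+-comm (suc ⌊ g /2⌋) _)) (cross-sum g′<2k g<2k))
                 (+-mod-cong (mod-subtract {k} {⌈ g /2⌉} {⌈ g′ /2⌉} {crossEnd B g} {crossEnd B g′} h₁ h₂) mod-refl)
    g≡g′ : g ≡ g′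
    g≡g′ = suc-injective (window-mod⇒≡ 2L≤g+1 2L≤g′+1 (below-window g≤P) (below-window g′≤P)
                                       (+-mod-cancelʳ k g+1≡g′+1))

  base-orbits-disjoint : ∀ κ κ′ {i j} → Valid κ → Valid κ′ → i < k → j < k →
                         SameEdge _≃_ (shiftₑ i (ends κ)) (shiftₑ j (ends κ′)) → i ≡ j
  base-orbits-disjoint (run s t) (run _ t′) v v′ i<k j<k (inj₁ (rot≃ h₁ , rot≃ h₂)) =
    runs-disjoint (base s) v v′ i<k j<k h₁ h₂
  base-orbits-disjoint (run s t) (run _ t′) v v′ _ _ (inj₂ (rot≃ h₁ , rot≃ h₂)) =
    ⊥-elim (runs-not-reversed (base s) v v′ h₁ h₂)
  base-orbits-disjoint (cross g) (cross g′) (v₁ , v₂) (v₁′ , v₂′) i<k j<k (inj₁ (rot≃ h₁ , rot≃ h₂)) =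
    crosses-disjoint v₁ v₂ v₁′ v₂′ i<k j<k h₁ h₂
  base-orbits-disjoint (spoke s r) (spoke _ _) _ _ i<k j<k (inj₁ (hub≃ , rot≃ h)) = shift-injective i<k j<k h
  base-orbits-disjoint (run _ _)   (cross _)   _ _ _ _ (inj₁ (rot≃ _ , ()))
  base-orbits-disjoint (run _ _)   (cross _)   _ _ _ _ (inj₂ (rot≃ _ , ()))
  base-orbits-disjoint (run _ _)   (spoke _ _) _ _ _ _ (inj₁ (() , _))
  base-orbits-disjoint (run _ _)   (spoke _ _) _ _ _ _ (inj₂ (_ , ()))
  base-orbits-disjoint (cross _)   (run _ _)   _ _ _ _ (inj₁ (rot≃ _ , ()))
  base-orbits-disjoint (cross _)   (run _ _)   _ _ _ _ (inj₂ (rot≃ _ , ()))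
  base-orbits-disjoint (cross _)   (cross _)   _ _ _ _ (inj₂ (() , _))
  base-orbits-disjoint (cross _)   (spoke _ _) _ _ _ _ (inj₁ (() , _))
  base-orbits-disjoint (cross _)   (spoke _ _) _ _ _ _ (inj₂ (_ , ()))
  base-orbits-disjoint (spoke _ _) (run _ _)   _ _ _ _ (inj₁ (() , _))
  base-orbits-disjoint (spoke _ _) (run _ _)   _ _ _ _ (inj₂ (() , _))
  base-orbits-disjoint (spoke _ _) (cross _)   _ _ _ _ (inj₁ (() , _))
  base-orbits-disjoint (spoke _ _) (cross _)   _ _ _ _ (inj₂ (() , _))
  base-orbits-disjoint (spoke _ _) (spoke _ _) _ _ _ _ (inj₂ (() , _))

  -- Position p of the base cycle shows w g (inj₁ g) or hub r (inj₂ r): first w 0, …, w (L − 1),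
  -- then hub 0, then w L, …, w P, and then alternately w (P + 1 + r) and hub (1 + r).
  slot : ℕ → ℕ ⊎ ℕ
  slot p = if p <ᵇ L then inj₁ p
           else if p <ᵇ suc L then inj₂ 0
           else if p <ᵇ P + 2 then inj₁ (p ∸ 1)
           else interleave (λ a → inj₁ (suc P + a)) (λ a → inj₂ (suc a)) (p ∸ (P + 2))

  point : ℕ ⊎ ℕ → Point
  point (inj₁ g) = w g
  point (inj₂ r) = hub r

  position : ℕ → Point
  position p = point (slot p)

  unslot : ℕ ⊎ ℕ → ℕ
  unslot (inj₁ g)       = if g <ᵇ L then g else if g <ᵇ suc P then suc g
                          else P + 2 + ((g ∸ suc P) + (g ∸ suc P))
  unslot (inj₂ zero)    = L
  unslot (inj₂ (suc r)) = P + 2 + suc (r + r)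

  slot-first : ∀ {p} → p < L → slot p ≡ inj₁ p
  slot-first = if-<

  slot-hub₀ : slot L ≡ inj₂ 0
  slot-hub₀ = trans (if-≥ (≤-refl {L})) (if-< (n<1+n L))

  slot-tail : ∀ q → slot (P + 2 + q) ≡ interleave (λ a → inj₁ (suc P + a)) (λ a → inj₂ (suc a)) q
  slot-tail q = begin
    slot (P + 2 + q) ≡⟨ if-≥ (≤-trans (<⇒≤ L<2L) 2L≤P+2+q) ⟩
    _                ≡⟨ if-≥ (≤-trans L<2L 2L≤P+2+q) ⟩
    _                ≡⟨ if-≥ (m≤m+n (P + 2) q) ⟩
    _                ≡⟨ cong (interleave _ _) (m+n∸m≡n (P + 2) q) ⟩
    interleave (λ a → inj₁ (suc P + a)) (λ a → inj₂ (suc a)) q ∎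
    where
    open ≡-Reasoning
    2L≤P+2+q : L + L ≤ P + 2 + q
    2L≤P+2+q = ≤-trans 2L≤P+2 (m≤m+n (P + 2) q)

  slot-tail-even : ∀ a → slot (P + 2 + (a + a)) ≡ inj₁ (suc P + a)
  slot-tail-even a = trans (slot-tail (a + a)) (interleave-even _ _ a)

  slot-tail-odd : ∀ a → slot (P + 2 + suc (a + a)) ≡ inj₂ (suc a)
  slot-tail-odd a = trans (slot-tail (suc (a + a))) (interleave-odd _ _ a)

  slot-middle : ∀ {g} → L ≤ g → g ≤ suc P → slot (suc g) ≡ inj₁ g
  slot-middle {g} L≤g g≤P+1 with m≤n⇒m<n∨m≡n g≤P+1
  ... | inj₁ g<P+1 = trans (if-≥ (≤-trans L≤g (n≤1+n g))) (trans (if-≥ (s≤s L≤g))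
                       (if-< (subst (suc g <_) (+-comm 2 P) (s≤s g<P+1))))
  ... | inj₂ refl  = begin
    slot (suc (suc P))     ≡⟨ cong slot (trans (+-comm 2 P) (sym (+-identityʳ (P + 2)))) ⟩
    slot (P + 2 + 0)       ≡⟨ slot-tail-even 0 ⟩
    inj₁ (suc P + 0)       ≡⟨ cong (inj₁ ∘ suc) (+-identityʳ P) ⟩
    inj₁ (suc P)           ∎
    where open ≡-Reasoning

  data Region : ℕ → Set where
    first  : ∀ {p} → p < L → Region p
    hub₀   : Region L
    middle : ∀ {g} → L ≤ g → g ≤ P → Region (suc g)
    tail   : ∀ q → Region (P + 2 + q)

  region : ∀ p → Region p
  region p with <-cmp p L
  ... | tri< p<L _ _ = first p<L
  ... | tri≈ _ refl _ = hub₀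
  ... | tri> _ _ L<p = beyond L<p
    where
    beyond : ∀ {p} → L < p → Region p
    beyond {suc g} (s≤s L≤g) with g ≤? P
    ... | yes g≤P = middle L≤g g≤P
    ... | no g≰P  = subst Region (trans (regroup P (g ∸ suc P)) (cong suc (m+[n∸m]≡n (≰⇒> g≰P)))) (tail (g ∸ suc P))
      where
      regroup : ∀ P d → P + 2 + d ≡ 1 + ((1 + P) + d)
      regroup = solve-∀

  unslot-slot : ∀ p → unslot (slot p) ≡ p
  unslot-slot p with region p
  ... | first p<L = trans (cong unslot (slot-first p<L)) (if-< p<L)
  ... | hub₀ = cong unslot slot-hub₀
  ... | middle L≤g g≤P =
    trans (cong unslot (slot-middle L≤g (≤-trans g≤P (n≤1+n P)))) (trans (if-≥ L≤g) (if-< (s≤s g≤P)))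
  ... | tail q with halves q
  ...   | odd a = cong unslot (slot-tail-odd a)
  ...   | even a = begin
    unslot (slot (P + 2 + (a + a)))                 ≡⟨ cong unslot (slot-tail-even a) ⟩
    unslot (inj₁ (suc P + a))                       ≡⟨ if-≥ (≤-trans L≤P+1 (m≤m+n (suc P) a)) ⟩
    _                                               ≡⟨ if-≥ (m≤m+n (suc P) a) ⟩
    P + 2 + ((suc P + a ∸ suc P) + (suc P + a ∸ suc P)) ≡⟨ cong (λ d → P + 2 + (d + d)) (m+n∸m≡n (suc P) a) ⟩
    P + 2 + (a + a)                                 ∎
    where open ≡-Reasoning

  tail-< : ∀ {q} → P + 2 + q < n → 2 + q < x + x
  tail-< {q} P+2+q<n = +-cancelˡ-< P (2 + q) (x + x) (begin-strict
    P + (2 + q) ≡⟨ +-assoc P 2 q ⟨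
    P + 2 + q   <⟨ P+2+q<n ⟩
    n           ≡⟨ trans n≡P+x+x (+-assoc P x x) ⟩
    P + (x + x) ∎)
    where open ≤-Reasoning

  hub-index< : ∀ {a} → 2 + (a + a) < x + x → suc a < x
  hub-index< {a} 2a+2<2x = +-double-< (subst (_< x + x) (sym (cong suc (+-suc a a))) 2a+2<2x)

  SlotBounded : ℕ ⊎ ℕ → Set
  SlotBounded (inj₁ g) = g < k + k
  SlotBounded (inj₂ r) = r < x

  slot-bounded : ∀ {p} → p < n → SlotBounded (slot p)
  slot-bounded {p} p<n with region p
  ... | first p<L = subst SlotBounded (sym (slot-first p<L)) (<-≤-trans p<L (≤-trans L≤k (m≤m+n k k)))
  ... | hub₀ = subst SlotBounded (sym slot-hub₀) (≤-trans (s≤s z≤n) 2≤x)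
  ... | middle L≤g g≤P = subst SlotBounded (sym (slot-middle L≤g (≤-trans g≤P (n≤1+n P)))) (≤-<-trans g≤P P<2k)
  ... | tail q with halves q
  ...   | even a = subst SlotBounded (sym (slot-tail-even a))
                     (subst (_< k + k) (+-suc P a) (subst (P + suc a <_) P+x≡2k (+-monoʳ-< P (hub-index< (tail-< p<n)))))
  ...   | odd a = subst SlotBounded (sym (slot-tail-odd a)) (hub-index< (<-trans (n<1+n _) (tail-< p<n)))

  rot≃-inv : ∀ {s s′ c c′} → rot s c ≃ rot s′ c′ → s ≡ s′ × (c ≡ c′ [mod k ])
  rot≃-inv (rot≃ c≡c′) = refl , c≡c′

  w-injective-≃ : ∀ {g g′} → g < k + k → g′ < k + k → w g ≃ w g′ → g ≡ g′
  w-injective-≃ g<2k g′<2k w≃w′ with w-normal g<2k | w-normal g′<2k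
  ... | s , c , c<k , w≡ | s′ , c′ , c′<k , w′≡
    with rot≃-inv (subst₂ _≃_ w≡ w′≡ w≃w′)
  ...   | refl , c≡c′ = w-injective g<2k g′<2k (trans w≡ (trans (cong (rot s) (<-mod⇒≡ c<k c′<k c≡c′)) (sym w′≡)))

  w≄hub : ∀ {g r} → g < k + k → w g ≃ hub r → ⊥
  w≄hub g<2k w≃hub with w-normal g<2k
  ... | s , c , _ , w≡ with subst (_≃ _) w≡ w≃hub
  ...   | ()

  point-injective : ∀ {σ τ} → SlotBounded σ → SlotBounded τ → point σ ≃ point τ → σ ≡ τ
  point-injective {inj₁ g} {inj₁ g′} g<2k g′<2k w≃w′ = cong inj₁ (w-injective-≃ g<2k g′<2k w≃w′)
  point-injective {inj₂ r} {inj₂ r′} _ _ hub≃ = refl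
  point-injective {inj₁ g} {inj₂ r} g<2k _ w≃hub = ⊥-elim (w≄hub g<2k w≃hub)
  point-injective {inj₂ r} {inj₁ g} _ g<2k hub≃w = ⊥-elim (w≄hub g<2k (IsEquivalence.sym ≃-isEquivalence hub≃w))

  copy : ℕ → ℕ → ℕ
  copy i p = vertex (shift i (position p))

  vertex-rot< : ∀ s c → vertex (rot s c) < k + k
  vertex-rot< A c = <-≤-trans (m%n<n c k) (m≤m+n k k)
  vertex-rot< B c = +-monoʳ-< k (m%n<n c k)

  copy-< : ∀ i {p} → p < n → copy i p < n
  copy-< i {p} p<n with slot p | slot-bounded p<n
  ... | inj₂ r | r<x  = +-monoʳ-< (k + k) r<x
  ... | inj₁ g | g<2k with w-normal g<2k
  ...   | s , c , _ , w≡ rewrite w≡ = <-≤-trans (vertex-rot< s (c + i)) (m≤m+n (k + k) x)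

  copy-injective : ∀ i {p p′} → p < n → p′ < n → copy i p ≡ copy i p′ → p ≡ p′
  copy-injective i {p} {p′} p<n p′<n eq = begin
    p                 ≡⟨ unslot-slot p ⟨
    unslot (slot p)   ≡⟨ cong unslot (point-injective (slot-bounded p<n) (slot-bounded p′<n)
                           (shift-cancel i (vertex-injective eq))) ⟩
    unslot (slot p′)  ≡⟨ unslot-slot p′ ⟩
    p′                ∎
    where open ≡-Reasoning

  position-first : ∀ {p} → p < L → position p ≡ runPoint A p
  position-first p<L = trans (cong point (slot-first p<L)) (w-runA p<L)

  position-hub₀ : position L ≡ hub 0
  position-hub₀ = cong point slot-hub₀

  position-middle : ∀ {g} → L ≤ g → g ≤ suc P → position (suc g) ≡ w g
  position-middle L≤g g≤P+1 = cong point (slot-middle L≤g g≤P+1)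

  ≡⇒≃ₑ : ∀ {a b c d} → SameEdge _≡_ (a , b) (c , d) → SameEdge _≃_ (a , b) (c , d)
  ≡⇒≃ₑ = SameEdge-map {_≈_ = _≡_} {_∼_ = _≃_} (λ p → p) ≃-reflexive

  run-adjacent : ∀ s {t} → suc t < L → SameEdge _≡_ (runPoint s t , runPoint s (suc t)) (ends (run s t))
  run-adjacent s {t} t+1<L = SameEdge-trans isEquivalence
    (SameEdge-cong (λ c → rot s (base s + c)) (zigzag-adjacent t+1<L))
    (inj₁ (refl , cong (rot s) (sym (+-assoc (base s) ⌈ t /2⌉ (L ∸ suc t)))))

  BaseEdgeAt : ℕ → Set
  BaseEdgeAt e = Σ BaseEdge λ κ → Valid κ × SameEdge _≃_ (position e , position ((e + 1) % n)) (ends κ)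

  first-edge : ∀ {e} → e < L → BaseEdgeAt e
  first-edge {e} e<L rewrite successor-mod (≤-<-trans e<L L<n) with m≤n⇒m<n∨m≡n e<L
  ... | inj₁ e+1<L = run A e , e+1<L ,
        ≡⇒≃ₑ (SameEdge-trans isEquivalence (inj₁ (position-first e<L , position-first e+1<L)) (run-adjacent A e+1<L))
  ... | inj₂ e+1≡L = spoke A 0 , tt ,
        inj₂ (≃-reflexive (trans (position-first e<L) (cong (runPoint A) (cong (_∸ 1) e+1≡L))) ,
              ≃-reflexive (trans (cong position e+1≡L) position-hub₀))

  hub₀-edge : BaseEdgeAt L
  hub₀-edge rewrite successor-mod (≤-<-trans (≤-trans L<2L 2L≤P+2) P+2<n) =
    spoke B 0 , tt , inj₁ (≃-reflexive position-hub₀ , ≃-reflexive (begin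
      position (suc L)           ≡⟨ position-middle ≤-refl L≤P+1 ⟩
      w L                        ≡⟨ w-runB ≤-refl L<2L ⟩
      runPoint B (L + L ∸ suc L) ≡⟨ cong (runPoint B) 2L∸[1+L]≡L∸1 ⟩
      rot B (spokeEnd B 0)       ∎))
    where open ≡-Reasoning

  middle-edge : ∀ {g} → L ≤ g → g ≤ P → BaseEdgeAt (suc g)
  middle-edge {g} L≤g g≤P rewrite successor-mod (≤-<-trans (subst (suc (suc g) ≤_) (+-comm 2 P) (s≤s (s≤s g≤P))) P+2<n)
                                | position-middle L≤g (≤-trans g≤P (n≤1+n P))
                                | position-middle (≤-trans L≤g (n≤1+n g)) (s≤s g≤P)
    with suc g <? L + L
  ... | no g+1≮2L = cross g , (≮⇒≥ g+1≮2L , g≤P) , ≡⇒≃ₑ (w-cross (≮⇒≥ g+1≮2L))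
  ... | yes g+1<2L = run B t , subst (_< L) t+1≡ (run-index< L≤g) , ≡⇒≃ₑ (SameEdge-trans isEquivalence
        (inj₂ (trans (w-runB L≤g (<-trans (n<1+n g) g+1<2L)) (cong (runPoint B) t+1≡) ,
               w-runB (≤-trans L≤g (n≤1+n g)) g+1<2L))
        (run-adjacent B (subst (_< L) t+1≡ (run-index< L≤g))))
    where
    t : ℕ
    t = L + L ∸ suc (suc g)
    t+1≡ : L + L ∸ suc g ≡ suc t
    t+1≡ = ∸-suc g+1<2L

  2L≤hub-neighbour : ∀ a → L + L ≤ suc (suc P + a)
  2L≤hub-neighbour a = ≤-trans 2L≤P+2 (subst (_≤ suc (suc P + a)) (+-comm 2 P) (s≤s (s≤s (m≤m+n P a))))

  tail-odd<n : ∀ {a} → suc a < x → P + 2 + suc (a + a) < n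
  tail-odd<n {a} a+1<x = begin-strict
    P + 2 + suc (a + a)        ≡⟨ regroup P a ⟩
    P + suc (suc a + suc a)    <⟨ +-monoʳ-< P (≤-trans (≤-reflexive (regroup′ a)) (+-mono-≤ a+1<x a+1<x)) ⟩
    P + (x + x)                ≡⟨ trans n≡P+x+x (+-assoc P x x) ⟨
    n                          ∎
    where
    open ≤-Reasoning
    regroup : ∀ P a → P + 2 + (1 + (a + a)) ≡ P + (1 + ((1 + a) + (1 + a)))
    regroup = solve-∀
    regroup′ : ∀ a → 2 + ((1 + a) + (1 + a)) ≡ (2 + a) + (2 + a)
    regroup′ = solve-∀

  position-tail-even : ∀ a → position (P + 2 + (a + a)) ≡ w (suc P + a)
  position-tail-even a = cong point (slot-tail-even a)

  position-tail-odd : ∀ a → position (P + 2 + suc (a + a)) ≡ hub (suc a)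
  position-tail-odd a = cong point (slot-tail-odd a)

  hub-neighbours : ∀ a → (∃ λ s → w (suc P + a) ≡ rot s (spokeEnd s (suc a))) ×
                         (∃ λ s → w (suc (suc P + a)) ≡ rot s (spokeEnd s (suc a)))
  hub-neighbours a with w-cross (2L≤hub-neighbour a)
  ... | inj₁ (w≡A , w′≡B) = (A , w≡A) , (B , w′≡B)
  ... | inj₂ (w≡B , w′≡A) = (B , w≡B) , (A , w′≡A)

  tail-even-edge : ∀ a → P + 2 + (a + a) < n → BaseEdgeAt (P + 2 + (a + a))
  tail-even-edge a e<n
    rewrite successor-mod (subst (_< n) (+-suc (P + 2) (a + a)) (tail-odd<n (hub-index< {a} (tail-< e<n))))
    with proj₁ (hub-neighbours a)
  ... | s , w≡ = spoke s (suc a) , tt ,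
        inj₂ (≃-reflexive (trans (position-tail-even a) w≡) ,
              ≃-reflexive (trans (cong position (sym (+-suc (P + 2) (a + a)))) (position-tail-odd a)))

  tail-wraps : ∀ a → suc (P + 2 + suc (a + a)) ≡ n → suc (suc P + a) ≡ k + k
  tail-wraps a e+1≡n = begin
    suc (suc P + a)     ≡⟨ regroup P a ⟩
    P + suc (suc a)     ≡⟨ cong (P +_) 2+a≡x ⟩
    P + x               ≡⟨ P+x≡2k ⟩
    k + k               ∎
    where
    open ≡-Reasoning
    regroup : ∀ P a → 1 + ((1 + P) + a) ≡ P + (2 + a)
    regroup = solve-∀
    regroup′ : ∀ P a → 1 + (P + 2 + (1 + (a + a))) ≡ P + ((2 + a) + (2 + a))
    regroup′ = solve-∀
    2+a≡x : suc (suc a) ≡ x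
    2+a≡x = +-double-injective (+-cancelˡ-≡ P _ _ (trans (sym (regroup′ P a))
              (trans e+1≡n (trans n≡P+x+x (+-assoc P x x)))))

  tail-successor : ∀ a → P + 2 + suc (a + a) < n →
                   position ((P + 2 + suc (a + a) + 1) % n) ≃ w (suc (suc P + a))
  tail-successor a e<n with suc-mod-cases e<n
  ... | inj₁ (_ , next≡) rewrite next≡ = ≃-reflexive (begin
    position (suc (P + 2 + suc (a + a))) ≡⟨ cong position (regroup P a) ⟩
    position (P + 2 + (suc a + suc a))   ≡⟨ position-tail-even (suc a) ⟩
    w (suc P + suc a)                    ≡⟨ cong w (+-suc (suc P) a) ⟩
    w (suc (suc P + a))                  ∎)
    where
    open ≡-Reasoning
    regroup : ∀ P a → 1 + (P + 2 + (1 + (a + a))) ≡ P + 2 + ((1 + a) + (1 + a))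
    regroup = solve-∀
  ... | inj₂ (e+1≡n , next≡0) rewrite next≡0 =
    -- The last hub closes the cycle: its crossing partner w (2k) = rot A k is rot A 0 = w 0 up to rotation.
    IsEquivalence.trans ≃-isEquivalence (≃-reflexive (position-first 1≤L))
      (IsEquivalence.trans ≃-isEquivalence (rot≃ (1 , 0 , refl))
        (≃-reflexive (sym (trans (cong w (tail-wraps a e+1≡n)) (w-even (+-mono-≤ L≤k L≤k))))))

  tail-odd-edge : ∀ a → P + 2 + suc (a + a) < n → BaseEdgeAt (P + 2 + suc (a + a))
  tail-odd-edge a e<n with proj₂ (hub-neighbours a)
  ... | s , w≡ = spoke s (suc a) , tt ,
        inj₁ (≃-reflexive (position-tail-odd a) ,
              IsEquivalence.trans ≃-isEquivalence (tail-successor a e<n) (≃-reflexive w≡))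

  base-edge : ∀ {e} → e < n → BaseEdgeAt e
  base-edge {e} e<n with region e
  ... | first e<L      = first-edge e<L
  ... | hub₀           = hub₀-edge
  ... | middle L≤g g≤P = middle-edge L≤g g≤P
  ... | tail q with halves q
  ...   | even a = tail-even-edge a e<n
  ...   | odd a  = tail-odd-edge a e<n

  shift-SameEdge : ∀ i {a b c d} → SameEdge _≃_ (a , b) (c , d) → SameEdge _≃_ (shift i a , shift i b) (shift i c , shift i d)
  shift-SameEdge i = SameEdge-map {_≈_ = _≃_} {_∼_ = _≃_} (shift i) (shift-≃ i)

  vertex-SameEdge : ∀ {a b c d} → SameEdge _≡_ (vertex a , vertex b) (vertex c , vertex d) → SameEdge _≃_ (a , b) (c , d)
  vertex-SameEdge = SameEdge-map {_≈_ = λ p q → vertex p ≡ vertex q} {_∼_ = _≃_} (λ p → p) vertex-injective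

  copies-edge-disjoint : ∀ {i j e e′} → i < k → j < k → e < n → e′ < n →
    SameEdge _≡_ (copy i e , copy i ((e + 1) % n)) (copy j e′ , copy j ((e′ + 1) % n)) → i ≡ j
  copies-edge-disjoint {i} {j} i<k j<k e<n e′<n same with base-edge e<n | base-edge e′<n
  ... | κ , valid , e≃κ | κ′ , valid′ , e′≃κ′ = base-orbits-disjoint κ κ′ valid valid′ i<k j<k
        (SameEdge-trans ≃-isEquivalence (SameEdge-sym ≃-isEquivalence (shift-SameEdge i e≃κ))
          (SameEdge-trans ≃-isEquivalence (vertex-SameEdge same) (shift-SameEdge j e′≃κ′)))

  copies : CycleCopies n k
  copies = record
    { copy = copy ; copy-< = copy-< ; copy-injective = copy-injective
    ; copies-edge-disjoint = copies-edge-disjoint }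

  label : ℕ → ℕ
  label v = if v <ᵇ k then 0 else if v <ᵇ k + k then 1 else 2 + (v ∸ (k + k))

  pointLabel : Point → ℕ
  pointLabel (rot A _) = 0
  pointLabel (rot B _) = 1
  pointLabel (hub r)   = 2 + r

  label-vertex : ∀ p → label (vertex p) ≡ pointLabel p
  label-vertex (rot A c) = if-< (m%n<n c k)
  label-vertex (rot B c) = trans (if-≥ (m≤m+n k _)) (if-< (+-monoʳ-< k (m%n<n c k)))
  label-vertex (hub r)   = trans (if-≥ (≤-trans (m≤m+n k k) (m≤m+n _ r)))
                             (trans (if-≥ (m≤m+n (k + k) r)) (cong (2 +_) (m+n∸m≡n (k + k) r)))

  pointLabel-shift : ∀ i p → pointLabel (shift i p) ≡ pointLabel p
  pointLabel-shift i (rot A _) = refl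
  pointLabel-shift i (rot B _) = refl
  pointLabel-shift i (hub _)   = refl

  label-< : ∀ {v} → v < n → label v < x + 2
  label-< {v} v<n with v <? k | v <? k + k
  ... | yes v<k | _        = subst (_< x + 2) (sym (if-< v<k)) (≤-trans (s≤s z≤n) (m≤n+m 2 x))
  ... | no v≮k  | yes v<2k = subst (_< x + 2) (sym (trans (if-≥ (≮⇒≥ v≮k)) (if-< v<2k))) (m≤n+m 2 x)
  ... | no v≮k  | no v≮2k  = subst (_< x + 2) (sym (trans (if-≥ (≮⇒≥ v≮k)) (if-≥ (≮⇒≥ v≮2k))))
                               (subst (2 + (v ∸ (k + k)) <_) (+-comm 2 x) (+-monoʳ-< 2
                                 (subst (v ∸ (k + k) <_) (m+n∸m≡n (k + k) x) (∸-monoˡ-< v<n (≮⇒≥ v≮2k)))))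

  label-surjective : ∀ {l} → l < x + 2 → ∃ λ v → v < n × label v ≡ l
  label-surjective {zero}        _ =
    0 , <-≤-trans (>-nonZero⁻¹ k) (≤-trans (m≤m+n k k) (m≤m+n (k + k) x)) , if-< (>-nonZero⁻¹ k)
  label-surjective {suc zero}    _ =
    k , <-≤-trans (m<m+n k (>-nonZero⁻¹ k)) (m≤m+n (k + k) x) , trans (if-≥ (≤-refl {k})) (if-< (m<m+n k (>-nonZero⁻¹ k)))
  label-surjective {suc (suc r)} r+2<x+2 =
    vertex (hub r) , +-monoʳ-< (k + k) (+-cancelʳ-< 2 r x (subst (_< x + 2) (+-comm 2 r) r+2<x+2)) , label-vertex (hub r)

  labels : InvariantLabelling n (x + 2) copy
  labels = record
    { label = label ; label-< = label-< ; label-surjective = label-surjective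
    ; label-invariant = λ i j e → trans (label-copy i e) (sym (label-copy j e)) }
    where
    label-copy : ∀ i e → label (copy i e) ≡ pointLabel (position e)
    label-copy i e = trans (label-vertex (shift i (position e))) (pointLabel-shift i (position e))

  λ≥ : LambdaAtLeast n (Cycle n) k (x + 2)
  λ≥ = λ≥-fromCopies ≤-refl copies labels

2*k≡k+k : ∀ k → 2 * k ≡ k + k
2*k≡k+k k = cong (k +_) (+-identityʳ k)

2k+1≡ : ∀ k → 2 * k + 1 ≡ suc (k + k)
2k+1≡ k = trans (+-comm (2 * k) 1) (cong suc (2*k≡k+k k))

λ≥-cycle-2k+1 : ∀ k {n} .{{_ : NonZero k}} .{{_ : NonZero n}} → n ≡ 2 * k + 1 →
  LambdaAtLeast n (Cycle n) k (if k % 2 ≡ᵇ 0 then 2 else 3)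
λ≥-cycle-2k+1 k n≡2k+1 with halves k
... | even a rewrite [n+n]%2≡0 a =
  λ≥-cong (sym (trans n≡2k+1 (2k+1≡ (a + a)))) (Walecki.λ≥ (a + a) 0 1 (1∣ _) (1∣ _))
... | odd a rewrite [1+n+n]%2≡1 a =
  λ≥-cong (sym (trans n≡2k+1 (2k+1≡ (suc (a + a)))))
    (Walecki.λ≥ (suc (a + a)) 1 2 (divides (suc a) (shift≡ a)) (divides (suc (a + a)) (n+n≡n*2 (suc (a + a)))))
  where
  shift≡ : ∀ a → 1 + 1 * (1 + (a + a)) ≡ (1 + a) * 2
  shift≡ = solve-∀

hub-parameter : ∀ k x → 1 ≤ k → 2 ≤ x → x ≤ k + k →
  ∃ λ L → 1 ≤ L × L + L ≤ suc k × L + L + x ≤ 2 + (k + k) × 2 + k ≤ L + L + x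
hub-parameter k x 1≤k 2≤x x≤2k with x ≤? k
... | yes x≤k = ⌈ k /2⌉ , ⌈n/2⌉-mono 1≤k , ⌊n/2⌋+⌊n/2⌋≤n (suc k) ,
                ≤-trans (+-mono-≤ (⌊n/2⌋+⌊n/2⌋≤n (suc k)) x≤k) (n≤1+n _) ,
                subst (_≤ ⌈ k /2⌉ + ⌈ k /2⌉ + x) (+-comm k 2) (+-mono-≤ (n≤⌈n/2⌉+⌈n/2⌉ k) 2≤x)
... | no x≰k  = 1 , ≤-refl , s≤s 1≤k , +-monoʳ-≤ 2 x≤2k , +-monoʳ-≤ 2 (<⇒≤ (≰⇒> x≰k))

λ≥-cycle-2k+x : ∀ k x {n} .{{_ : NonZero k}} .{{_ : NonZero n}} → 2 ≤ x → x ≤ k + k → n ≡ 2 * k + x →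
          LambdaAtLeast n (Cycle n) k (x + 2)
λ≥-cycle-2k+x k x 2≤x x≤2k n≡2k+x with hub-parameter k x (>-nonZero⁻¹ k) 2≤x x≤2k
... | L , 1≤L , 2L≤k+1 , 2L+x≤2k+2 , k+2≤2L+x =
  λ≥-cong (sym (trans n≡2k+x (cong (_+ x) (2*k≡k+k k)))) (HubCycle.λ≥ k L x 1≤L 2L≤k+1 2≤x 2L+x≤2k+2 k+2≤2L+x)

mainTheorem1 : (k x n : ℕ) → 2 ≤ k → 1 ≤ x → x ≤ 2 * k ∸ 1 →
    n ≡ 2 * k + x → .{{_ : NonZero n}} →
    LambdaAtLeast n (Cycle n) k (if (x ≡ᵇ 1) ∧ (k % 2 ≡ᵇ 0) then 2 else x + 2)
mainTheorem1 k (suc zero) n (s≤s (s≤s _)) _ _ n≡2k+1 = λ≥-cycle-2k+1 k n≡2k+1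
mainTheorem1 k x@(suc (suc _)) n (s≤s (s≤s _)) _ x≤2k∸1 n≡2k+x = λ≥-cycle-2k+x k x (s≤s (s≤s z≤n)) x≤2k n≡2k+x
  where
  x≤2k : x ≤ k + k
  x≤2k = ≤-trans x≤2k∸1 (≤-trans (m∸n≤m (2 * k) 1) (≤-reflexive (2*k≡k+k k)))
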